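{- Let $r$, $s$, $c$, $d$ and $a_n$ be any integers with $r\neq0$, and suppose $p^2-4q\neq0$ and $U_r$, $V_d$, $V_{r+d}$ are nonzero. If $n$ is a positive even integer, then \[ \begin{split} &\sum_{a_{n-1}=c}^{a_n}\sum_{a_{n-2}=c}^{a_{n-1}}\cdots\sum_{a_0=c}^{a_1}\left(\frac{V_d}{V_{r+d}}\right)^{a_0}W_{ra_0+s} =\frac{1}{q^{dn}\Delta^n}\left(\frac{V_d}{U_r}\right)^n\left(\frac{V_d}{V_{r+d}}\right)^{a_n}W_{r(n+a_n)+dn+s}\\ &\quad-\left(\frac{V_d}{V_{r+d}}\right)^{c-1}\frac{1}{\Delta^n}\sum_{j=0}^{(n-2)/2}\frac{\Delta^{2j}}{q^{d(n-2j)}}\left(\frac{V_d}{U_r}\right)^{n-2j}W_{(r+d)(n-2j)+r(c-1)+s}\binom{a_n+2j-c}{2j}\\ &\quad-\left(\frac{V_d}{V_{r+d}}\right)^{c-1}\frac{1}{\Delta^{n+2}}\sum_{j=1}^{n/2}\frac{\Delta^{2j}}{q^{d(n-2j+1)}}\left(\frac{V_d}{U_r}\right)^{n-2j+1}\Big(W_{(r+d)(n-2j+1)+r(c-1)+s+1}-qW_{(r+d)(n-2j+1)+r(c-1)+s-1}\Big)\binom{a_n+2j-1-c}{2j-1}, \end{split} \] while if $n$ is a positive odd integer, then \[ \begin{split} &\sum_{a_{n-1}=c}^{a_n}\sum_{a_{n-2}=c}^{a_{n-1}}\cdots\sum_{a_0=c}^{a_1}\left(\frac{V_d}{V_{r+d}}\right)^{a_0}W_{ra_0+s}\\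 &=\frac{1}{q^{dn}\Delta^{n+1}}\left(\frac{V_d}{U_r}\right)^n\left(\frac{V_d}{V_{r+d}}\right)^{a_n}\Big(W_{r(n+a_n)+dn+s+1}-qW_{r(n+a_n)+dn+s-1}\Big)\\ &\quad-\left(\frac{V_d}{V_{r+d}}\right)^{c-1}\frac{1}{\Delta^{n+1}}\sum_{j=0}^{(n-1)/2}\frac{\Delta^{2j}}{q^{d(n-2j)}}\left(\frac{V_d}{U_r}\right)^{n-2j}\Big(W_{(r+d)(n-2j)+r(c-1)+s+1}-qW_{(r+d)(n-2j)+r(c-1)+s-1}\Big)\binom{a_n+2j-c}{2j}\\ &\quad-\left(\frac{V_d}{V_{r+d}}\right)^{c-1}\frac{1}{\Delta^{n+1}}\sum_{j=1}^{(n-1)/2}\frac{\Delta^{2j}}{q^{d(n-2j+1)}}\left(\frac{V_d}{U_r}\right)^{n-2j+1}W_{(r+d)(n-2j+1)+r(c-1)+s}\binom{a_n+2j-1-c}{2j-1}. \end{split} \]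
   Context: Let $a,b,p,q$ be complex numbers with $p\neq0$, $q\neq0$. The Horadam sequence $W_j=W_j(a,b;p,q)$ is defined by $W_0=a$, $W_1=b$, $W_j=pW_{j-1}-qW_{j-2}$ for $j\ge2$, and extended to negative indices by $W_{j}=(pW_{j+1}-W_{j+2})/q$, so the recurrence holds for all integers $j$. $U_j=W_j(0,1;p,q)$ and $V_j=W_j(2,p;p,q)$ are the Lucas sequences of the first and second kind (same $p,q$). $\tau=(p+\sqrt{p^2-4q})/2$ and $\sigma=(p-\sqrt{p^2-4q})/2$ are the roots of $x^2-px+q$ (for a fixed choice of square root) and $\Delta=\tau-\sigma=\sqrt{p^2-4q}$. The left sides are iterated sums with $n$ summation signs: $a_{n-1}$ runs from $c$ to $a_n$, and for each $i$ the index $a_{i-1}$ runs from $c$ to $a_i$. Summation convention: for integers $m,M$, $\sum_{k=m}^{M}h(k)$ is the usual sum if $M\ge m$, equals $0$ if $M=m-1$, and equals $-\sum_{k=M+1}^{m-1}h(k)$ if $M\le m-2$ (in particular the last sum in the odd case is empty when $n=1$). For an integer $N$ and a non-negative integer $j$, $\binom{N}{j}=N(N-1)\cdots(N-j+1)/j!$. -}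

module Defs where

open import Level using (Level; _⊔_)
open import Algebra.Bundles using (CommutativeRing)
open import Data.Nat as ℕ using (ℕ; zero; suc)
open import Data.Integer as ℤ using (ℤ; +_; -[1+_])
open import Data.Product using (_×_; _,_; proj₁)
open import Relation.Nullary using (¬_)

-- A field of characteristic zero, presented as a commutative ring together
-- with a multiplicative inverse for every nonzero element.
-- (agda-stdlib has no complex numbers and no Field bundle.)
module _ {c ℓ : Level} (R : CommutativeRing c ℓ) where
  open CommutativeRing R

  ℕ→R : ℕ → Carrier
  ℕ→R zero    = 0#
  ℕ→R (suc n) = 1# + ℕ→R n

  record IsCharZeroField : Set (c ⊔ ℓ) where
    field
      _⁻¹       : Carrier → Carrier
      ⁻¹-inverse : ∀ x → ¬ (x ≈ 0#) → x * (x ⁻¹) ≈ 1#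
      charZero  : ∀ n → ¬ (ℕ→R (suc n) ≈ 0#)

module Horadam {c ℓ : Level} (R : CommutativeRing c ℓ) (F : IsCharZeroField R) where
  open CommutativeRing R
  open IsCharZeroField F

  infixl 6 _−_
  _−_ : Carrier → Carrier → Carrier
  x − y = x + - y

  infixl 7 _/_
  _/_ : Carrier → Carrier → Carrier
  x / y = x * (y ⁻¹)

  ℤ→R : ℤ → Carrier
  ℤ→R (+ n)     = ℕ→R R n
  ℤ→R -[1+ n ]  = - ℕ→R R (suc n)

  infixr 8 _^_
  _^_ : Carrier → ℕ → Carrier
  x ^ zero  = 1#
  x ^ suc n = x * (x ^ n)

  infixr 8 _^ᶻ_
  _^ᶻ_ : Carrier → ℤ → Carrier
  x ^ᶻ (+ n)     = x ^ n
  x ^ᶻ -[1+ n ]  = (x ⁻¹) ^ suc n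

  Σ< : ℕ → (ℕ → Carrier) → Carrier
  Σ< zero    f = 0#
  Σ< (suc k) f = Σ< k f + f k

  -- Σ_{j=lo}^{hi} f j over naturals (empty if hi < lo)
  Σℕ[_to_] : ℕ → ℕ → (ℕ → Carrier) → Carrier
  Σℕ[ lo to hi ] f = Σ< (suc hi ℕ.∸ lo) (λ i → f (lo ℕ.+ i))

  -- Σ_{k=m}^{M} h k over integers, with the paper's convention:
  -- usual sum if M ≥ m, 0 if M = m-1, and -Σ_{k=M+1}^{m-1} h k if M ≤ m-2.
  Σℤ[_to_] : ℤ → ℤ → (ℤ → Carrier) → Carrier
  Σℤ[ m to M ] h with M ℤ.- m ℤ.+ ℤ.1ℤ
  ... | + k       = Σ< k (λ i → h (m ℤ.+ + i))
  ... | -[1+ k ]  = - Σ< (suc k) (λ i → h ((M ℤ.+ ℤ.1ℤ) ℤ.+ + i))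

  fallingℤ : ℤ → ℕ → Carrier
  fallingℤ N zero    = 1#
  fallingℤ N (suc j) = fallingℤ N j * ℤ→R (N ℤ.- + j)

  factorial : ℕ → Carrier
  factorial zero    = 1#
  factorial (suc j) = ℕ→R R (suc j) * factorial j

  binom : ℤ → ℕ → Carrier
  binom N j = fallingℤ N j / factorial j

  fwd : Carrier → Carrier → Carrier × Carrier → Carrier × Carrier
  fwd p q (x , y) = (y , p * y − q * x)

  bwd : Carrier → Carrier → Carrier × Carrier → Carrier × Carrier
  bwd p q (x , y) = ((p * x − y) / q , x)

  iterate : (Carrier × Carrier → Carrier × Carrier) → ℕ → Carrier × Carrier → Carrier × Carrier
  iterate g zero    z = z
  iterate g (suc n) z = g (iterate g n z)

  W : Carrier → Carrier → Carrier → Carrier → ℤ → Carrier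
  W a b p q (+ n)     = proj₁ (iterate (fwd p q) n (a , b))
  W a b p q -[1+ n ]  = proj₁ (iterate (bwd p q) (suc n) (a , b))

  U : Carrier → Carrier → ℤ → Carrier
  U p q = W 0# 1# p q

  V : Carrier → Carrier → ℤ → Carrier
  V p q = W (ℕ→R R 2) p p q

  -- n-fold iterated sum
  --   Σ_{a_{n-1}=c}^{a_n} ... Σ_{a_0=c}^{a_1} g(a_0),   as a function of a_n
  iterSum : ℕ → ℤ → (ℤ → Carrier) → ℤ → Carrier
  iterSum zero    c g x = g x
  iterSum (suc n) c g x = Σℤ[ c to x ] (iterSum n c g)

-- By Binet's formula W k = A τᵏ + B σᵏ, the summand ρᵃ W (r a + s) is α z₁ᵃ + β z₂ᵃ with
-- z₁ = ρ τʳ and z₂ = ρ σʳ, so by linearity it suffices to sum geometric sequences. With the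
-- paper's convention, Σ_{k=c}^{x} h is the unique H with H (c - 1) = 0 and H x = H (x - 1) + h x;
-- hence, whenever u (z - 1) = z, induction on n with Pascal's rule shows that the n-fold iterated
-- sum of zᵃ from c up to x is z^(c-1) (uⁿ zᵗ - Σ_{k<n} C(t - 1 + k, k) u^(n-k)), t = x - c + 1.
-- The choice of ρ makes u₁ = θ τ^(r+d) and u₂ = -θ σ^(r+d) admissible, θ = V_d / (U_r q^d Δ).
-- Recombining, every term becomes A τᵏ + (-1)ᵉ B σᵏ, which is W k for even e and
-- (W (k+1) - q W (k-1)) / Δ for odd e; splitting the binomial sum by the parity of its index
-- gives the two formulas.
module Submission where

open import Defs
open import Level using (Level)
open import Algebra.Bundles using (CommutativeRing)
open import Data.Nat as ℕ using (ℕ; zero; suc)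
open import Data.Integer as ℤ using (ℤ; +_; -[1+_])
open import Data.Product using (_×_; _,_; proj₁; proj₂)
open import Data.Maybe using (Maybe; map)
open import Relation.Nullary using (¬_)
open import Relation.Nullary.Decidable using (dec⇒maybe)
open import Relation.Binary.PropositionalEquality as ≡ using (_≡_; _≢_)
import Data.Nat.Properties as ℕP
import Data.Integer.Properties as ℤP
open import Data.Integer.Tactic.RingSolver using (solve-∀)
import Algebra.Solver.Ring
open import Algebra.Solver.Ring.AlmostCommutativeRing
  using (_-Raw-AlmostCommutative⟶_; fromCommutativeRing)

-- Integer and natural-number arithmetic

ℤ-induction : ∀ {p} (P : ℤ → Set p) → P ℤ.0ℤ →
              (∀ i → P i → P (ℤ.suc i)) → (∀ i → P i → P (ℤ.pred i)) → ∀ i → P i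
ℤ-induction P P0 Psuc Ppred (+ zero)        = P0
ℤ-induction P P0 Psuc Ppred (+ suc n)       = Psuc (+ n) (ℤ-induction P P0 Psuc Ppred (+ n))
ℤ-induction P P0 Psuc Ppred -[1+ zero ]     = Ppred ℤ.0ℤ P0
ℤ-induction P P0 Psuc Ppred -[1+ suc n ]    = Ppred -[1+ n ] (ℤ-induction P P0 Psuc Ppred -[1+ n ])

+-suc : ∀ i j → i ℤ.+ (ℤ.1ℤ ℤ.+ j) ≡ ℤ.1ℤ ℤ.+ (i ℤ.+ j)
+-suc = solve-∀

*-pred : ∀ i j → i ℤ.* (ℤ.-1ℤ ℤ.+ j) ≡ ℤ.- i ℤ.+ i ℤ.* j
*-pred = solve-∀

[c+k]-1≡[c-1]+k : ∀ c k → c ℤ.+ k ℤ.- ℤ.1ℤ ≡ c ℤ.- ℤ.1ℤ ℤ.+ k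
[c+k]-1≡[c-1]+k = solve-∀

[c-1]+[1+k]≡c+k : ∀ c k → c ℤ.- ℤ.1ℤ ℤ.+ (ℤ.1ℤ ℤ.+ k) ≡ c ℤ.+ k
[c-1]+[1+k]≡c+k = solve-∀

[c-1]+[x-c+1]≡x : ∀ c x → c ℤ.- ℤ.1ℤ ℤ.+ (x ℤ.- c ℤ.+ ℤ.1ℤ) ≡ x
[c-1]+[x-c+1]≡x = solve-∀

[x+y]-y≡x : ∀ x y → x ℤ.+ y ℤ.- y ≡ x
[x+y]-y≡x = solve-∀

[x+[1+k]]-1≡x+k : ∀ x k → x ℤ.+ (ℤ.1ℤ ℤ.+ k) ℤ.- ℤ.1ℤ ≡ x ℤ.+ k
[x+[1+k]]-1≡x+k = solve-∀

x+[1+k]≡[x+1]+k : ∀ x k → x ℤ.+ (ℤ.1ℤ ℤ.+ k) ≡ x ℤ.+ ℤ.1ℤ ℤ.+ k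
x+[1+k]≡[x+1]+k = solve-∀

N-[1+k]≡[N-1]-k : ∀ N k → N ℤ.- (ℤ.1ℤ ℤ.+ k) ≡ N ℤ.- ℤ.1ℤ ℤ.- k
N-[1+k]≡[N-1]-k = solve-∀

N≡[N-1-k]+[1+k] : ∀ N k → N ≡ N ℤ.- ℤ.1ℤ ℤ.- k ℤ.+ (ℤ.1ℤ ℤ.+ k)
N≡[N-1-k]+[1+k] = solve-∀

[t-1+[1+k]]-1≡[t-1-1]+[1+k] : ∀ t k → t ℤ.- ℤ.1ℤ ℤ.+ (ℤ.1ℤ ℤ.+ k) ℤ.- ℤ.1ℤ ≡ t ℤ.- ℤ.1ℤ ℤ.- ℤ.1ℤ ℤ.+ (ℤ.1ℤ ℤ.+ k)
[t-1+[1+k]]-1≡[t-1-1]+[1+k] = solve-∀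

[t-1+[1+k]]-1≡t-1+k : ∀ t k → t ℤ.- ℤ.1ℤ ℤ.+ (ℤ.1ℤ ℤ.+ k) ℤ.- ℤ.1ℤ ≡ t ℤ.- ℤ.1ℤ ℤ.+ k
[t-1+[1+k]]-1≡t-1+k = solve-∀

1+[t-1]≡t : ∀ t → ℤ.1ℤ ℤ.+ (t ℤ.- ℤ.1ℤ) ≡ t
1+[t-1]≡t = solve-∀

c+[x-c]≡x : ∀ c x → c ℤ.+ (x ℤ.- c) ≡ x
c+[x-c]≡x = solve-∀

x-1-c≡x-c-1 : ∀ x c → x ℤ.- ℤ.1ℤ ℤ.- c ≡ x ℤ.- c ℤ.- ℤ.1ℤ
x-1-c≡x-c-1 = solve-∀

suc-[1+n]≡-n : ∀ n → ℤ.suc -[1+ n ] ≡ ℤ.- + n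
suc-[1+n]≡-n zero    = ≡.refl
suc-[1+n]≡-n (suc n) = ≡.refl

k+1≡1+[1+[k-1]] : ∀ k → k ℤ.+ ℤ.1ℤ ≡ ℤ.1ℤ ℤ.+ (ℤ.1ℤ ℤ.+ (k ℤ.- ℤ.1ℤ))
k+1≡1+[1+[k-1]] = solve-∀

x-[c-1]-1+k≡x+k-c : ∀ x c k → x ℤ.- (c ℤ.- ℤ.1ℤ) ℤ.- ℤ.1ℤ ℤ.+ k ≡ x ℤ.+ k ℤ.- c
x-[c-1]-1+k≡x+k-c = solve-∀

[r+d]*n+r*x+s≡r*[n+x]+d*n+s : ∀ r d n x s → (r ℤ.+ d) ℤ.* n ℤ.+ r ℤ.* x ℤ.+ s ≡ r ℤ.* (n ℤ.+ x) ℤ.+ d ℤ.* n ℤ.+ s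
[r+d]*n+r*x+s≡r*[n+x]+d*n+s = solve-∀

x+[1+k]-c≡x+[2+k]-1-c : ∀ x k c → x ℤ.+ (ℤ.1ℤ ℤ.+ k) ℤ.- c ≡ x ℤ.+ (ℤ.1ℤ ℤ.+ (ℤ.1ℤ ℤ.+ k)) ℤ.- ℤ.1ℤ ℤ.- c
x+[1+k]-c≡x+[2+k]-1-c = solve-∀

j+[[n∸j]+a]≡n+a : ∀ {j n} → j ℕ.≤ n → ∀ a → j ℕ.+ ((n ℕ.∸ j) ℕ.+ a) ≡ n ℕ.+ a
j+[[n∸j]+a]≡n+a {j} {n} j≤n a = ≡.trans (≡.sym (ℕP.+-assoc j (n ℕ.∸ j) a)) (≡.cong (ℕ._+ a) (ℕP.m+[n∸m]≡n j≤n))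

j+[[[n∸j]+1]+a]≡n+[1+a] : ∀ {j n} → j ℕ.≤ n → ∀ a → j ℕ.+ (((n ℕ.∸ j) ℕ.+ 1) ℕ.+ a) ≡ n ℕ.+ (1 ℕ.+ a)
j+[[[n∸j]+1]+a]≡n+[1+a] {j} {n} j≤n a =
  ≡.trans (≡.cong (j ℕ.+_) (ℕP.+-assoc (n ℕ.∸ j) 1 a)) (j+[[n∸j]+a]≡n+a j≤n (1 ℕ.+ a))

n∸[1+2j]≡[n∸2[1+j]]+1 : ∀ {n} j → 2 ℕ.* suc j ℕ.≤ n → n ℕ.∸ suc (2 ℕ.* j) ≡ (n ℕ.∸ 2 ℕ.* suc j) ℕ.+ 1
n∸[1+2j]≡[n∸2[1+j]]+1 {n} j 2[1+j]≤n = ≡.trans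
  (≡.trans (ℕP.+-∸-assoc 1 (≡.subst (ℕ._≤ n) (ℕP.*-suc 2 j) 2[1+j]≤n)) (ℕP.+-comm 1 _))
  (≡.cong (λ t → (n ℕ.∸ t) ℕ.+ 1) (≡.sym (ℕP.*-suc 2 j)))

[2m+1]∸2j≡2[m∸j]+1 : ∀ m j → j ℕ.≤ m → (2 ℕ.* m ℕ.+ 1) ℕ.∸ 2 ℕ.* j ≡ 2 ℕ.* (m ℕ.∸ j) ℕ.+ 1
[2m+1]∸2j≡2[m∸j]+1 m j j≤m = ≡.trans (ℕP.+-∸-comm 1 (ℕP.*-monoʳ-≤ 2 j≤m))
                                       (≡.cong (ℕ._+ 1) (≡.sym (ℕP.*-distribˡ-∸ 2 m j)))

2i+1+1≡2[1+i] : ∀ i → 2 ℕ.* i ℕ.+ 1 ℕ.+ 1 ≡ 2 ℕ.* suc i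
2i+1+1≡2[1+i] i = ≡.trans (ℕP.+-assoc (2 ℕ.* i) 1 1) (≡.trans (ℕP.+-comm (2 ℕ.* i) 2) (≡.sym (ℕP.*-suc 2 i)))

module _ {c ℓ} (R : CommutativeRing c ℓ) (F : IsCharZeroField R) where
  open CommutativeRing R
  open IsCharZeroField F
  open Horadam R F
  open import Relation.Binary.Reasoning.Setoid setoid
  open import Algebra.Properties.Ring ring using (-‿distribˡ-*; -‿distribʳ-*; -0#≈0#)
  open import Algebra.Properties.AbelianGroup +-abelianGroup using (⁻¹-∙-comm; inverseʳ-unique)
  open import Algebra.Properties.CommutativeSemigroup +-commutativeSemigroup
    using () renaming (x∙yz≈y∙xz to x+[y+z]≈y+[x+z])
  open import Algebra.Properties.CommutativeSemigroup *-commutativeSemigroup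
    using () renaming (x∙yz≈y∙xz to x*[y*z]≈y*[x*z]; interchange to *-interchange)

  -- The embedding ℤ → R and the ring solver

  ℤ→R-suc : ∀ i → ℤ→R (ℤ.suc i) ≈ 1# + ℤ→R i
  ℤ→R-suc (+ n)            = refl
  ℤ→R-suc -[1+ zero ]      = begin
    0#              ≈⟨ -‿inverseʳ 1# ⟨
    1# + - 1#       ≈⟨ +-congˡ (-‿cong (+-identityʳ 1#)) ⟨
    1# + - (1# + 0#) ∎
  ℤ→R-suc -[1+ suc n ]     = begin
    - (1# + ℕ→R R n)                  ≈⟨ +-identityˡ _ ⟨
    0# + - (1# + ℕ→R R n)             ≈⟨ +-congʳ (-‿inverseʳ 1#) ⟨
    (1# + - 1#) + - (1# + ℕ→R R n)    ≈⟨ +-assoc _ _ _ ⟩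
    1# + (- 1# + - (1# + ℕ→R R n))    ≈⟨ +-congˡ (⁻¹-∙-comm 1# (1# + ℕ→R R n)) ⟩
    1# + - (1# + (1# + ℕ→R R n))      ∎

  ℤ→R-pred : ∀ i → ℤ→R (ℤ.pred i) ≈ - 1# + ℤ→R i
  ℤ→R-pred i = begin
    ℤ→R (ℤ.pred i)                   ≈⟨ +-identityˡ _ ⟨
    0# + ℤ→R (ℤ.pred i)              ≈⟨ +-congʳ (-‿inverseˡ 1#) ⟨
    (- 1# + 1#) + ℤ→R (ℤ.pred i)     ≈⟨ +-assoc _ _ _ ⟩
    - 1# + (1# + ℤ→R (ℤ.pred i))     ≈⟨ +-congˡ (ℤ→R-suc (ℤ.pred i)) ⟨
    - 1# + ℤ→R (ℤ.suc (ℤ.pred i))    ≡⟨ ≡.cong (λ j → - 1# + ℤ→R j) (ℤP.suc-pred i) ⟩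
    - 1# + ℤ→R i                     ∎

  ℤ→R-+ : ∀ i j → ℤ→R (i ℤ.+ j) ≈ ℤ→R i + ℤ→R j
  ℤ→R-+ i = ℤ-induction (λ j → ℤ→R (i ℤ.+ j) ≈ ℤ→R i + ℤ→R j)
    (trans (reflexive (≡.cong ℤ→R (ℤP.+-identityʳ i))) (sym (+-identityʳ _)))
    (λ j ih → begin
      ℤ→R (i ℤ.+ ℤ.suc j)    ≡⟨ ≡.cong ℤ→R (+-suc i j) ⟩
      ℤ→R (ℤ.suc (i ℤ.+ j))  ≈⟨ ℤ→R-suc (i ℤ.+ j) ⟩
      1# + ℤ→R (i ℤ.+ j)     ≈⟨ +-congˡ ih ⟩
      1# + (ℤ→R i + ℤ→R j)   ≈⟨ x+[y+z]≈y+[x+z] 1# (ℤ→R i) (ℤ→R j) ⟩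
      ℤ→R i + (1# + ℤ→R j)   ≈⟨ +-congˡ (ℤ→R-suc j) ⟨
      ℤ→R i + ℤ→R (ℤ.suc j)  ∎)
    (λ j ih → begin
      ℤ→R (i ℤ.+ ℤ.pred j)    ≡⟨ ≡.cong ℤ→R (ℤP.+-pred i j) ⟩
      ℤ→R (ℤ.pred (i ℤ.+ j))  ≈⟨ ℤ→R-pred (i ℤ.+ j) ⟩
      - 1# + ℤ→R (i ℤ.+ j)    ≈⟨ +-congˡ ih ⟩
      - 1# + (ℤ→R i + ℤ→R j)  ≈⟨ x+[y+z]≈y+[x+z] (- 1#) (ℤ→R i) (ℤ→R j) ⟩
      ℤ→R i + (- 1# + ℤ→R j)  ≈⟨ +-congˡ (ℤ→R-pred j) ⟨
      ℤ→R i + ℤ→R (ℤ.pred j)  ∎)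

  ℤ→R-neg : ∀ i → ℤ→R (ℤ.- i) ≈ - ℤ→R i
  ℤ→R-neg i = inverseʳ-unique _ _ (begin
    ℤ→R i + ℤ→R (ℤ.- i)   ≈⟨ ℤ→R-+ i (ℤ.- i) ⟨
    ℤ→R (i ℤ.+ ℤ.- i)     ≡⟨ ≡.cong ℤ→R (ℤP.+-inverseʳ i) ⟩
    0#                    ∎)

  ℤ→R-* : ∀ i j → ℤ→R (i ℤ.* j) ≈ ℤ→R i * ℤ→R j
  ℤ→R-* i = ℤ-induction (λ j → ℤ→R (i ℤ.* j) ≈ ℤ→R i * ℤ→R j)
    (trans (reflexive (≡.cong ℤ→R (ℤP.*-zeroʳ i))) (sym (zeroʳ _)))
    (λ j ih → begin
      ℤ→R (i ℤ.* ℤ.suc j)          ≡⟨ ≡.cong ℤ→R (ℤP.*-suc i j) ⟩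
      ℤ→R (i ℤ.+ i ℤ.* j)          ≈⟨ ℤ→R-+ i (i ℤ.* j) ⟩
      ℤ→R i + ℤ→R (i ℤ.* j)        ≈⟨ +-cong (sym (*-identityʳ _)) ih ⟩
      ℤ→R i * 1# + ℤ→R i * ℤ→R j   ≈⟨ distribˡ _ _ _ ⟨
      ℤ→R i * (1# + ℤ→R j)         ≈⟨ *-congˡ (ℤ→R-suc j) ⟨
      ℤ→R i * ℤ→R (ℤ.suc j)        ∎)
    (λ j ih → begin
      ℤ→R (i ℤ.* ℤ.pred j)            ≡⟨ ≡.cong ℤ→R (*-pred i j) ⟩
      ℤ→R (ℤ.- i ℤ.+ i ℤ.* j)         ≈⟨ ℤ→R-+ (ℤ.- i) (i ℤ.* j) ⟩
      ℤ→R (ℤ.- i) + ℤ→R (i ℤ.* j)     ≈⟨ +-cong (ℤ→R-neg i) ih ⟩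
      - ℤ→R i + ℤ→R i * ℤ→R j         ≈⟨ +-congʳ (-‿cong (*-identityʳ _)) ⟨
      - (ℤ→R i * 1#) + ℤ→R i * ℤ→R j  ≈⟨ +-congʳ (-‿distribʳ-* _ _) ⟩
      ℤ→R i * - 1# + ℤ→R i * ℤ→R j    ≈⟨ distribˡ _ _ _ ⟨
      ℤ→R i * (- 1# + ℤ→R j)          ≈⟨ *-congˡ (ℤ→R-pred j) ⟨
      ℤ→R i * ℤ→R (ℤ.pred j)          ∎)

  -- ℤ→R reads 1 as 1# + 0#. The solver is instantiated with this variant, which reads it as 1#,
  -- so that the identities it proves contain the constant one as 1#.
  ℕ→R₁ : ℕ → Carrier
  ℕ→R₁ zero          = 0#
  ℕ→R₁ (suc zero)    = 1#
  ℕ→R₁ (suc (suc n)) = 1# + ℕ→R₁ (suc n)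

  ℤ→R₁ : ℤ → Carrier
  ℤ→R₁ (+ n)     = ℕ→R₁ n
  ℤ→R₁ -[1+ n ]  = - ℕ→R₁ (suc n)

  ℕ→R₁≈ℕ→R : ∀ n → ℕ→R₁ n ≈ ℕ→R R n
  ℕ→R₁≈ℕ→R zero          = refl
  ℕ→R₁≈ℕ→R (suc zero)    = sym (+-identityʳ 1#)
  ℕ→R₁≈ℕ→R (suc (suc n)) = +-congˡ (ℕ→R₁≈ℕ→R (suc n))

  ℤ→R₁≈ℤ→R : ∀ i → ℤ→R₁ i ≈ ℤ→R i
  ℤ→R₁≈ℤ→R (+ n)    = ℕ→R₁≈ℕ→R n
  ℤ→R₁≈ℤ→R -[1+ n ] = -‿cong (ℕ→R₁≈ℕ→R (suc n))

  ℤ⟶R : CommutativeRing.rawRing ℤP.+-*-commutativeRing -Raw-AlmostCommutative⟶ fromCommutativeRing R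
  ℤ⟶R = record
    { ⟦_⟧    = ℤ→R₁
    ; +-homo = λ i j → transport {i ℤ.+ j} (ℤ→R-+ i j) (+-cong (ℤ→R₁≈ℤ→R i) (ℤ→R₁≈ℤ→R j))
    ; *-homo = λ i j → transport {i ℤ.* j} (ℤ→R-* i j) (*-cong (ℤ→R₁≈ℤ→R i) (ℤ→R₁≈ℤ→R j))
    ; -‿homo = λ i → transport {ℤ.- i} (ℤ→R-neg i) (-‿cong (ℤ→R₁≈ℤ→R i))
    ; 0-homo = refl
    ; 1-homo = refl
    }
    where
    transport : ∀ {i x y} → ℤ→R i ≈ x → y ≈ x → ℤ→R₁ i ≈ y
    transport {i} e e′ = trans (ℤ→R₁≈ℤ→R i) (trans e (sym e′))

  ℤ→R₁-≟ : ∀ i j → Maybe (ℤ→R₁ i ≈ ℤ→R₁ j)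
  ℤ→R₁-≟ i j = map (λ i≡j → reflexive (≡.cong ℤ→R₁ i≡j)) (dec⇒maybe (i ℤ.≟ j))

  open Algebra.Solver.Ring (CommutativeRing.rawRing ℤP.+-*-commutativeRing) (fromCommutativeRing R) ℤ⟶R ℤ→R₁-≟
    using (solve; _:=_; _:+_; _:*_; _:-_; :-_; con)

  -- Inverses and powers

  1≉0 : ¬ (1# ≈ 0#)
  1≉0 1≈0 = charZero 0 (trans (+-identityʳ 1#) 1≈0)

  ⁻¹-inverseʳ : ∀ {x} → ¬ (x ≈ 0#) → x * x ⁻¹ ≈ 1#
  ⁻¹-inverseʳ {x} = ⁻¹-inverse x

  ⁻¹-inverseˡ : ∀ {x} → ¬ (x ≈ 0#) → x ⁻¹ * x ≈ 1#
  ⁻¹-inverseˡ x≉0 = trans (*-comm _ _) (⁻¹-inverseʳ x≉0)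

  *-nonzero : ∀ {x y} → ¬ (x ≈ 0#) → ¬ (y ≈ 0#) → ¬ (x * y ≈ 0#)
  *-nonzero {x} {y} x≉0 y≉0 xy≈0 = x≉0 (begin
    x               ≈⟨ *-identityʳ x ⟨
    x * 1#          ≈⟨ *-congˡ (⁻¹-inverseʳ y≉0) ⟨
    x * (y * y ⁻¹)  ≈⟨ *-assoc _ _ _ ⟨
    (x * y) * y ⁻¹  ≈⟨ *-congʳ xy≈0 ⟩
    0# * y ⁻¹       ≈⟨ zeroˡ _ ⟩
    0#              ∎)

  ⁻¹-nonzero : ∀ {x} → ¬ (x ≈ 0#) → ¬ (x ⁻¹ ≈ 0#)
  ⁻¹-nonzero {x} x≉0 x⁻¹≈0 = 1≉0 (begin
    1#        ≈⟨ ⁻¹-inverseʳ x≉0 ⟨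
    x * x ⁻¹  ≈⟨ *-congˡ x⁻¹≈0 ⟩
    x * 0#    ≈⟨ zeroʳ x ⟩
    0#        ∎)

  ⁻¹-unique : ∀ {x y} → ¬ (x ≈ 0#) → x * y ≈ 1# → y ≈ x ⁻¹
  ⁻¹-unique {x} {y} x≉0 xy≈1 = begin
    y               ≈⟨ *-identityʳ y ⟨
    y * 1#          ≈⟨ *-congˡ (⁻¹-inverseʳ x≉0) ⟨
    y * (x * x ⁻¹)  ≈⟨ x*[y*z]≈y*[x*z] y x (x ⁻¹) ⟩
    x * (y * x ⁻¹)  ≈⟨ *-assoc x y (x ⁻¹) ⟨
    (x * y) * x ⁻¹  ≈⟨ *-congʳ xy≈1 ⟩
    1# * x ⁻¹       ≈⟨ *-identityˡ _ ⟩
    x ⁻¹            ∎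

  ⁻¹-cong : ∀ {x y} → x ≈ y → ¬ (y ≈ 0#) → x ⁻¹ ≈ y ⁻¹
  ⁻¹-cong {x} {y} x≈y y≉0 = ⁻¹-unique y≉0 (begin
    y * x ⁻¹  ≈⟨ *-congʳ x≈y ⟨
    x * x ⁻¹  ≈⟨ ⁻¹-inverseʳ (λ x≈0 → y≉0 (trans (sym x≈y) x≈0)) ⟩
    1#        ∎)

  ⁻¹-distrib-* : ∀ {x y} → ¬ (x ≈ 0#) → ¬ (y ≈ 0#) → (x * y) ⁻¹ ≈ x ⁻¹ * y ⁻¹
  ⁻¹-distrib-* {x} {y} x≉0 y≉0 = sym (⁻¹-unique (*-nonzero x≉0 y≉0) (begin
    (x * y) * (x ⁻¹ * y ⁻¹)    ≈⟨ *-interchange x y (x ⁻¹) (y ⁻¹) ⟩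
    (x * x ⁻¹) * (y * y ⁻¹)    ≈⟨ *-cong (⁻¹-inverseʳ x≉0) (⁻¹-inverseʳ y≉0) ⟩
    1# * 1#                    ≈⟨ *-identityʳ 1# ⟩
    1#                         ∎))

  1⁻¹≈1 : 1# ⁻¹ ≈ 1#
  1⁻¹≈1 = sym (⁻¹-unique 1≉0 (*-identityʳ 1#))

  ^-homo-* : ∀ x m n → x ^ (m ℕ.+ n) ≈ x ^ m * x ^ n
  ^-homo-* x zero    n = sym (*-identityˡ _)
  ^-homo-* x (suc m) n = trans (*-congˡ (^-homo-* x m n)) (sym (*-assoc _ _ _))

  ^-congˡ : ∀ {x y} n → x ≈ y → x ^ n ≈ y ^ n
  ^-congˡ zero    x≈y = refl
  ^-congˡ (suc n) x≈y = *-cong x≈y (^-congˡ n x≈y)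

  ^-distrib-* : ∀ x y n → (x * y) ^ n ≈ x ^ n * y ^ n
  ^-distrib-* x y zero    = sym (*-identityʳ 1#)
  ^-distrib-* x y (suc n) = trans (*-congˡ (^-distrib-* x y n)) (*-interchange x y (x ^ n) (y ^ n))

  ^-nonzero : ∀ {x} n → ¬ (x ≈ 0#) → ¬ (x ^ n ≈ 0#)
  ^-nonzero zero    x≉0 = 1≉0
  ^-nonzero (suc n) x≉0 = *-nonzero x≉0 (^-nonzero n x≉0)

  ⁻¹-^ : ∀ {x} n → ¬ (x ≈ 0#) → (x ⁻¹) ^ n ≈ (x ^ n) ⁻¹
  ⁻¹-^ zero    x≉0 = sym 1⁻¹≈1
  ⁻¹-^ (suc n) x≉0 = trans (*-congˡ (⁻¹-^ n x≉0)) (sym (⁻¹-distrib-* x≉0 (^-nonzero n x≉0)))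

  [-x]^n≈[-1]^n*x^n : ∀ x n → (- x) ^ n ≈ (- 1#) ^ n * x ^ n
  [-x]^n≈[-1]^n*x^n x n =
    trans (^-congˡ n (trans (-‿cong (sym (*-identityˡ x))) (-‿distribˡ-* 1# x))) (^-distrib-* (- 1#) x n)

  [-1]^[2n]≈1 : ∀ n → (- 1#) ^ (2 ℕ.* n) ≈ 1#
  [-1]^[2n]≈1 n = begin
    (- 1#) ^ (n ℕ.+ (n ℕ.+ 0))          ≡⟨ ≡.cong (λ k → (- 1#) ^ (n ℕ.+ k)) (ℕP.+-identityʳ n) ⟩
    (- 1#) ^ (n ℕ.+ n)                  ≈⟨ ^-homo-* (- 1#) n n ⟩
    (- 1#) ^ n * (- 1#) ^ n             ≈⟨ ^-distrib-* (- 1#) (- 1#) n ⟨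
    (- 1# * - 1#) ^ n                   ≈⟨ ^-congˡ n [-1]*[-1]≈1 ⟩
    1# ^ n                              ≈⟨ 1^n≈1 n ⟩
    1#                                  ∎
    where
    [-1]*[-1]≈1 : - 1# * - 1# ≈ 1#
    [-1]*[-1]≈1 = solve 0 (:- con ℤ.1ℤ :* :- con ℤ.1ℤ := con ℤ.1ℤ) refl
    1^n≈1 : ∀ n → 1# ^ n ≈ 1#
    1^n≈1 zero    = refl
    1^n≈1 (suc n) = trans (*-identityˡ _) (1^n≈1 n)

  [-1]^[2n+1]≈-1 : ∀ n → (- 1#) ^ (2 ℕ.* n ℕ.+ 1) ≈ - 1#
  [-1]^[2n+1]≈-1 n = begin
    (- 1#) ^ (2 ℕ.* n ℕ.+ 1)        ≈⟨ ^-homo-* (- 1#) (2 ℕ.* n) 1 ⟩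
    (- 1#) ^ (2 ℕ.* n) * (- 1# * 1#) ≈⟨ *-cong ([-1]^[2n]≈1 n) (*-identityʳ (- 1#)) ⟩
    1# * - 1#                       ≈⟨ *-identityˡ (- 1#) ⟩
    - 1#                            ∎

  module _ {x : Carrier} (x≉0 : ¬ (x ≈ 0#)) where

    ^ᶻ-suc : ∀ i → x ^ᶻ ℤ.suc i ≈ x * x ^ᶻ i
    ^ᶻ-suc (+ n)            = refl
    ^ᶻ-suc -[1+ zero ]      = sym (trans (*-congˡ (*-identityʳ _)) (⁻¹-inverseʳ x≉0))
    ^ᶻ-suc -[1+ suc n ]     = sym (begin
      x * (x ⁻¹ * (x ⁻¹) ^ suc n)  ≈⟨ *-assoc _ _ _ ⟨
      (x * x ⁻¹) * (x ⁻¹) ^ suc n  ≈⟨ *-congʳ (⁻¹-inverseʳ x≉0) ⟩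
      1# * (x ⁻¹) ^ suc n          ≈⟨ *-identityˡ _ ⟩
      (x ⁻¹) ^ suc n               ∎)

    ^ᶻ-pred : ∀ i → x ^ᶻ ℤ.pred i ≈ x ⁻¹ * x ^ᶻ i
    ^ᶻ-pred i = begin
      x ^ᶻ ℤ.pred i                  ≈⟨ *-identityˡ _ ⟨
      1# * x ^ᶻ ℤ.pred i             ≈⟨ *-congʳ (⁻¹-inverseˡ x≉0) ⟨
      (x ⁻¹ * x) * x ^ᶻ ℤ.pred i     ≈⟨ *-assoc _ _ _ ⟩
      x ⁻¹ * (x * x ^ᶻ ℤ.pred i)     ≈⟨ *-congˡ (^ᶻ-suc (ℤ.pred i)) ⟨
      x ⁻¹ * x ^ᶻ ℤ.suc (ℤ.pred i)   ≡⟨ ≡.cong (λ j → x ⁻¹ * x ^ᶻ j) (ℤP.suc-pred i) ⟩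
      x ⁻¹ * x ^ᶻ i                  ∎

    ^ᶻ-suc-suc : ∀ i → x ^ᶻ ℤ.suc (ℤ.suc i) ≈ (x * x) * x ^ᶻ i
    ^ᶻ-suc-suc i = trans (^ᶻ-suc (ℤ.suc i)) (trans (*-congˡ (^ᶻ-suc i)) (sym (*-assoc x x _)))

    ^ᶻ-nonzero : ∀ i → ¬ (x ^ᶻ i ≈ 0#)
    ^ᶻ-nonzero (+ n)    = ^-nonzero n x≉0
    ^ᶻ-nonzero -[1+ n ] = ^-nonzero (suc n) (⁻¹-nonzero x≉0)

    ^ᶻ-homo-* : ∀ i j → x ^ᶻ (i ℤ.+ j) ≈ x ^ᶻ i * x ^ᶻ j
    ^ᶻ-homo-* i = ℤ-induction (λ j → x ^ᶻ (i ℤ.+ j) ≈ x ^ᶻ i * x ^ᶻ j)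
      (trans (reflexive (≡.cong (x ^ᶻ_) (ℤP.+-identityʳ i))) (sym (*-identityʳ _)))
      (λ j ih → begin
        x ^ᶻ (i ℤ.+ ℤ.suc j)      ≡⟨ ≡.cong (x ^ᶻ_) (+-suc i j) ⟩
        x ^ᶻ ℤ.suc (i ℤ.+ j)      ≈⟨ ^ᶻ-suc (i ℤ.+ j) ⟩
        x * x ^ᶻ (i ℤ.+ j)        ≈⟨ *-congˡ ih ⟩
        x * (x ^ᶻ i * x ^ᶻ j)     ≈⟨ x*[y*z]≈y*[x*z] x (x ^ᶻ i) (x ^ᶻ j) ⟩
        x ^ᶻ i * (x * x ^ᶻ j)     ≈⟨ *-congˡ (^ᶻ-suc j) ⟨
        x ^ᶻ i * x ^ᶻ ℤ.suc j     ∎)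
      (λ j ih → begin
        x ^ᶻ (i ℤ.+ ℤ.pred j)     ≡⟨ ≡.cong (x ^ᶻ_) (ℤP.+-pred i j) ⟩
        x ^ᶻ ℤ.pred (i ℤ.+ j)     ≈⟨ ^ᶻ-pred (i ℤ.+ j) ⟩
        x ⁻¹ * x ^ᶻ (i ℤ.+ j)     ≈⟨ *-congˡ ih ⟩
        x ⁻¹ * (x ^ᶻ i * x ^ᶻ j)  ≈⟨ x*[y*z]≈y*[x*z] (x ⁻¹) (x ^ᶻ i) (x ^ᶻ j) ⟩
        x ^ᶻ i * (x ⁻¹ * x ^ᶻ j)  ≈⟨ *-congˡ (^ᶻ-pred j) ⟨
        x ^ᶻ i * x ^ᶻ ℤ.pred j    ∎)

    ^ᶻ-neg : ∀ i → x ^ᶻ (ℤ.- i) ≈ (x ^ᶻ i) ⁻¹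
    ^ᶻ-neg i = ⁻¹-unique (^ᶻ-nonzero i) (begin
      x ^ᶻ i * x ^ᶻ (ℤ.- i)  ≈⟨ ^ᶻ-homo-* i (ℤ.- i) ⟨
      x ^ᶻ (i ℤ.+ ℤ.- i)     ≡⟨ ≡.cong (x ^ᶻ_) (ℤP.+-inverseʳ i) ⟩
      1#                     ∎)

  ^ᶻ-assocʳ : ∀ {x} → ¬ (x ≈ 0#) → ∀ i j → (x ^ᶻ i) ^ᶻ j ≈ x ^ᶻ (i ℤ.* j)
  ^ᶻ-assocʳ {x} x≉0 i j = sym (x^[i*j]≈[x^i]^j j)
    where
    x^[i*j]≈[x^i]^j : ∀ j → x ^ᶻ (i ℤ.* j) ≈ (x ^ᶻ i) ^ᶻ j
    x^[i*j]≈[x^i]^j = ℤ-induction (λ j → x ^ᶻ (i ℤ.* j) ≈ (x ^ᶻ i) ^ᶻ j)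
      (reflexive (≡.cong (x ^ᶻ_) (ℤP.*-zeroʳ i)))
      (λ j ih → begin
        x ^ᶻ (i ℤ.* ℤ.suc j)         ≡⟨ ≡.cong (x ^ᶻ_) (ℤP.*-suc i j) ⟩
        x ^ᶻ (i ℤ.+ i ℤ.* j)         ≈⟨ ^ᶻ-homo-* x≉0 i (i ℤ.* j) ⟩
        x ^ᶻ i * x ^ᶻ (i ℤ.* j)      ≈⟨ *-congˡ ih ⟩
        x ^ᶻ i * (x ^ᶻ i) ^ᶻ j       ≈⟨ ^ᶻ-suc (^ᶻ-nonzero x≉0 i) j ⟨
        (x ^ᶻ i) ^ᶻ ℤ.suc j          ∎)
      (λ j ih → begin
        x ^ᶻ (i ℤ.* ℤ.pred j)        ≡⟨ ≡.cong (x ^ᶻ_) (*-pred i j) ⟩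
        x ^ᶻ (ℤ.- i ℤ.+ i ℤ.* j)     ≈⟨ ^ᶻ-homo-* x≉0 (ℤ.- i) (i ℤ.* j) ⟩
        x ^ᶻ (ℤ.- i) * x ^ᶻ (i ℤ.* j) ≈⟨ *-cong (^ᶻ-neg x≉0 i) ih ⟩
        (x ^ᶻ i) ⁻¹ * (x ^ᶻ i) ^ᶻ j  ≈⟨ ^ᶻ-pred (^ᶻ-nonzero x≉0 i) j ⟨
        (x ^ᶻ i) ^ᶻ ℤ.pred j         ∎)

  ^ᶻ-distrib-* : ∀ {x y} → ¬ (x ≈ 0#) → ¬ (y ≈ 0#) → ∀ i → (x * y) ^ᶻ i ≈ x ^ᶻ i * y ^ᶻ i
  ^ᶻ-distrib-* {x} {y} x≉0 y≉0 = ℤ-induction (λ i → (x * y) ^ᶻ i ≈ x ^ᶻ i * y ^ᶻ i)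
    (sym (*-identityʳ 1#))
    (λ i ih → begin
      (x * y) ^ᶻ ℤ.suc i                ≈⟨ ^ᶻ-suc xy≉0 i ⟩
      (x * y) * (x * y) ^ᶻ i            ≈⟨ *-congˡ ih ⟩
      (x * y) * (x ^ᶻ i * y ^ᶻ i)       ≈⟨ *-interchange x y _ _ ⟩
      (x * x ^ᶻ i) * (y * y ^ᶻ i)       ≈⟨ *-cong (^ᶻ-suc x≉0 i) (^ᶻ-suc y≉0 i) ⟨
      x ^ᶻ ℤ.suc i * y ^ᶻ ℤ.suc i       ∎)
    (λ i ih → begin
      (x * y) ^ᶻ ℤ.pred i               ≈⟨ ^ᶻ-pred xy≉0 i ⟩
      (x * y) ⁻¹ * (x * y) ^ᶻ i         ≈⟨ *-cong (⁻¹-distrib-* x≉0 y≉0) ih ⟩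
      (x ⁻¹ * y ⁻¹) * (x ^ᶻ i * y ^ᶻ i) ≈⟨ *-interchange (x ⁻¹) (y ⁻¹) _ _ ⟩
      (x ⁻¹ * x ^ᶻ i) * (y ⁻¹ * y ^ᶻ i) ≈⟨ *-cong (^ᶻ-pred x≉0 i) (^ᶻ-pred y≉0 i) ⟨
      x ^ᶻ ℤ.pred i * y ^ᶻ ℤ.pred i     ∎)
    where
    xy≉0 : ¬ (x * y ≈ 0#)
    xy≉0 = *-nonzero x≉0 y≉0

  ^ᶻ-congˡ : ∀ {x y} → x ≈ y → ¬ (y ≈ 0#) → ∀ i → x ^ᶻ i ≈ y ^ᶻ i
  ^ᶻ-congˡ x≈y y≉0 (+ n)    = ^-congˡ n x≈y
  ^ᶻ-congˡ x≈y y≉0 -[1+ n ] = ^-congˡ (suc n) (⁻¹-cong x≈y y≉0)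

  x-[y+z]≈x-y-z : ∀ x y z → x − (y + z) ≈ x − y − z
  x-[y+z]≈x-y-z = solve 3 (λ x y z → x :- (y :+ z) := x :- y :- z) refl

  -- Finite sums and the iterated sum

  Σ<-cong : ∀ n {f g : ℕ → Carrier} → (∀ i → i ℕ.< n → f i ≈ g i) → Σ< n f ≈ Σ< n g
  Σ<-cong zero    f≈g = refl
  Σ<-cong (suc n) f≈g = +-cong (Σ<-cong n (λ i i<n → f≈g i (ℕP.m<n⇒m<1+n i<n))) (f≈g n ℕP.≤-refl)

  Σ<-linear : ∀ n α β (f g : ℕ → Carrier) →
              Σ< n (λ i → α * f i + β * g i) ≈ α * Σ< n f + β * Σ< n g
  Σ<-linear zero    α β f g = sym (trans (+-cong (zeroʳ α) (zeroʳ β)) (+-identityʳ 0#))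
  Σ<-linear (suc n) α β f g = trans (+-congʳ (Σ<-linear n α β f g)) (regroup α β _ _ _ _)
    where
    regroup : ∀ α β F G a b → (α * F + β * G) + (α * a + β * b) ≈ α * (F + a) + β * (G + b)
    regroup = solve 6 (λ α β F G a b → (α :* F :+ β :* G) :+ (α :* a :+ β :* b)
                                      := α :* (F :+ a) :+ β :* (G :+ b)) refl

  *-distribˡ-Σ< : ∀ n α (f : ℕ → Carrier) → α * Σ< n f ≈ Σ< n (λ i → α * f i)
  *-distribˡ-Σ< zero    α f = zeroʳ α
  *-distribˡ-Σ< (suc n) α f = trans (distribˡ α _ _) (+-congʳ (*-distribˡ-Σ< n α f))

  Σ<-even+odd : ∀ M (f : ℕ → Carrier) →
                Σ< (2 ℕ.* M) f ≈ Σ< M (λ j → f (2 ℕ.* j)) + Σ< M (λ j → f (suc (2 ℕ.* j)))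
  Σ<-even+odd zero    f = sym (+-identityʳ 0#)
  Σ<-even+odd (suc M) f = begin
    Σ< (2 ℕ.* suc M) f                             ≡⟨ ≡.cong (λ n → Σ< n f) (ℕP.*-suc 2 M) ⟩
    (Σ< (2 ℕ.* M) f + f (2 ℕ.* M)) + f (suc (2 ℕ.* M)) ≈⟨ +-congʳ (+-congʳ (Σ<-even+odd M f)) ⟩
    ((E + O) + f (2 ℕ.* M)) + f (suc (2 ℕ.* M))    ≈⟨ regroup E O _ _ ⟩
    (E + f (2 ℕ.* M)) + (O + f (suc (2 ℕ.* M)))    ∎
    where
    E O : Carrier
    E = Σ< M (λ j → f (2 ℕ.* j))
    O = Σ< M (λ j → f (suc (2 ℕ.* j)))
    regroup : ∀ E O a b → ((E + O) + a) + b ≈ (E + a) + (O + b)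
    regroup = solve 4 (λ E O a b → ((E :+ O) :+ a) :+ b := (E :+ a) :+ (O :+ b)) refl

  Σ<-odd-length : ∀ M (f : ℕ → Carrier) →
                  Σ< (suc (2 ℕ.* M)) f ≈ Σ< (suc M) (λ j → f (2 ℕ.* j)) + Σ< M (λ j → f (suc (2 ℕ.* j)))
  Σ<-odd-length M f = trans (+-congʳ (Σ<-even+odd M f)) (regroup _ _ _)
    where
    regroup : ∀ E O a → (E + O) + a ≈ (E + a) + O
    regroup = solve 3 (λ E O a → (E :+ O) :+ a := (E :+ a) :+ O) refl

  module _ (c : ℤ) {h H : ℤ → Carrier}
           (H[c-1]≈0 : H (c ℤ.- ℤ.1ℤ) ≈ 0#) (H-step : ∀ x → H x ≈ H (x ℤ.- ℤ.1ℤ) + h x) where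

    private
      upward : ∀ k → Σ< k (λ i → h (c ℤ.+ + i)) ≈ H (c ℤ.- ℤ.1ℤ ℤ.+ + k)
      upward zero    = trans (sym H[c-1]≈0) (reflexive (≡.cong H (≡.sym (ℤP.+-identityʳ _))))
      upward (suc k) = begin
        Σ< k (λ i → h (c ℤ.+ + i)) + h (c ℤ.+ + k)   ≈⟨ +-congʳ (upward k) ⟩
        H (c ℤ.- ℤ.1ℤ ℤ.+ + k) + h (c ℤ.+ + k)       ≡⟨ ≡.cong (λ y → H y + h (c ℤ.+ + k)) ([c+k]-1≡[c-1]+k c (+ k)) ⟨
        H (c ℤ.+ + k ℤ.- ℤ.1ℤ) + h (c ℤ.+ + k)       ≈⟨ H-step (c ℤ.+ + k) ⟨
        H (c ℤ.+ + k)                                ≡⟨ ≡.cong H ([c-1]+[1+k]≡c+k c (+ k)) ⟨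
        H (c ℤ.- ℤ.1ℤ ℤ.+ + suc k)                   ∎

      downward : ∀ y k → H y ≈ H (y ℤ.+ + k) − Σ< k (λ i → h (y ℤ.+ ℤ.1ℤ ℤ.+ + i))
      downward y zero    = begin
        H y                      ≡⟨ ≡.cong H (ℤP.+-identityʳ y) ⟨
        H (y ℤ.+ + 0)            ≈⟨ +-identityʳ _ ⟨
        H (y ℤ.+ + 0) + 0#       ≈⟨ +-congˡ -0#≈0# ⟨
        H (y ℤ.+ + 0) + - 0#     ∎
      downward y (suc k) = begin
        H y                                      ≈⟨ downward y k ⟩
        H (y ℤ.+ + k) − S                        ≡⟨ ≡.cong (λ t → H t − S) ([x+[1+k]]-1≡x+k y (+ k)) ⟨
        H (y ℤ.+ + suc k ℤ.- ℤ.1ℤ) − S           ≈⟨ regroup _ S (h (y ℤ.+ + suc k)) ⟩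
        (H (y ℤ.+ + suc k ℤ.- ℤ.1ℤ) + h (y ℤ.+ + suc k)) − (S + h (y ℤ.+ + suc k))
                                                 ≈⟨ +-congʳ (H-step _) ⟨
        H (y ℤ.+ + suc k) − (S + h (y ℤ.+ + suc k))
                                    ≡⟨ ≡.cong (λ t → H (y ℤ.+ + suc k) − (S + h t)) (x+[1+k]≡[x+1]+k y (+ k)) ⟩
        H (y ℤ.+ + suc k) − (S + h (y ℤ.+ ℤ.1ℤ ℤ.+ + k)) ∎
        where
        S = Σ< k (λ i → h (y ℤ.+ ℤ.1ℤ ℤ.+ + i))
        regroup : ∀ a S b → a − S ≈ (a + b) − (S + b)
        regroup = solve 3 (λ a S b → a :- S := (a :+ b) :- (S :+ b)) refl

    Σℤ-unique : ∀ x → Σℤ[ c to x ] h ≈ H x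
    Σℤ-unique x with x ℤ.- c ℤ.+ ℤ.1ℤ in eq
    ... | + k      = trans (upward k) (reflexive (≡.cong H (≡.trans (≡.cong (λ t → c ℤ.- ℤ.1ℤ ℤ.+ t) (≡.sym eq)) ([c-1]+[x-c+1]≡x c x))))
    ... | -[1+ k ] = begin
      - S                        ≈⟨ +-identityˡ _ ⟨
      0# + - S                   ≈⟨ +-congʳ H[c-1]≈0 ⟨
      H (c ℤ.- ℤ.1ℤ) − S         ≡⟨ ≡.cong (λ t → H t − S) c-1≡x+[1+k] ⟩
      H (x ℤ.+ + suc k) − S      ≈⟨ downward x (suc k) ⟨
      H x                        ∎
      where
      S = Σ< (suc k) (λ i → h ((x ℤ.+ ℤ.1ℤ) ℤ.+ + i))
      c-1≡x+[1+k] : c ℤ.- ℤ.1ℤ ≡ x ℤ.+ + suc k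
      c-1≡x+[1+k] = ≡.trans (≡.sym ([x+y]-y≡x (c ℤ.- ℤ.1ℤ) (x ℤ.- c ℤ.+ ℤ.1ℤ)))
                            (≡.cong₂ ℤ._-_ ([c-1]+[x-c+1]≡x c x) eq)

  Σℤ-cong : ∀ m M {f g : ℤ → Carrier} → (∀ k → f k ≈ g k) → Σℤ[ m to M ] f ≈ Σℤ[ m to M ] g
  Σℤ-cong m M f≈g with M ℤ.- m ℤ.+ ℤ.1ℤ
  ... | + k      = Σ<-cong k (λ i _ → f≈g _)
  ... | -[1+ k ] = -‿cong (Σ<-cong (suc k) (λ i _ → f≈g _))

  Σℤ-linear : ∀ m M α β (f g : ℤ → Carrier) →
              Σℤ[ m to M ] (λ k → α * f k + β * g k) ≈ α * Σℤ[ m to M ] f + β * Σℤ[ m to M ] g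
  Σℤ-linear m M α β f g with M ℤ.- m ℤ.+ ℤ.1ℤ
  ... | + k      = Σ<-linear k α β _ _
  ... | -[1+ k ] = trans (-‿cong (Σ<-linear (suc k) α β _ _)) (negate α β _ _)
    where
    negate : ∀ α β F G → - (α * F + β * G) ≈ α * - F + β * - G
    negate = solve 4 (λ α β F G → :- (α :* F :+ β :* G) := α :* :- F :+ β :* :- G) refl

  iterSum-cong : ∀ n c {f g : ℤ → Carrier} → (∀ k → f k ≈ g k) → ∀ x → iterSum n c f x ≈ iterSum n c g x
  iterSum-cong zero    c f≈g x = f≈g x
  iterSum-cong (suc n) c f≈g x = Σℤ-cong c x (iterSum-cong n c f≈g)

  iterSum-linear : ∀ n c α β (f g : ℤ → Carrier) x →
                   iterSum n c (λ k → α * f k + β * g k) x ≈ α * iterSum n c f x + β * iterSum n c g x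
  iterSum-linear zero    c α β f g x = refl
  iterSum-linear (suc n) c α β f g x =
    trans (Σℤ-cong c x (iterSum-linear n c α β f g)) (Σℤ-linear c x α β _ _)

  factorial-nonzero : ∀ k → ¬ (factorial k ≈ 0#)
  factorial-nonzero zero    = 1≉0
  factorial-nonzero (suc k) = *-nonzero (charZero k) (factorial-nonzero k)

  fallingℤ-suc : ∀ N k → fallingℤ N (suc k) ≈ ℤ→R N * fallingℤ (N ℤ.- ℤ.1ℤ) k
  fallingℤ-suc N zero    = begin
    1# * ℤ→R (N ℤ.- + 0)   ≈⟨ *-identityˡ _ ⟩
    ℤ→R (N ℤ.- + 0)        ≡⟨ ≡.cong ℤ→R (ℤP.+-identityʳ N) ⟩
    ℤ→R N                  ≈⟨ *-identityʳ _ ⟨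
    ℤ→R N * 1#             ∎
  fallingℤ-suc N (suc k) = begin
    fallingℤ N (suc k) * ℤ→R (N ℤ.- + suc k)                            ≈⟨ *-congʳ (fallingℤ-suc N k) ⟩
    (ℤ→R N * fallingℤ (N ℤ.- ℤ.1ℤ) k) * ℤ→R (N ℤ.- + suc k)             ≡⟨ ≡.cong (λ t → (ℤ→R N * fallingℤ (N ℤ.- ℤ.1ℤ) k) * ℤ→R t) (N-[1+k]≡[N-1]-k N (+ k)) ⟩
    (ℤ→R N * fallingℤ (N ℤ.- ℤ.1ℤ) k) * ℤ→R (N ℤ.- ℤ.1ℤ ℤ.- + k)       ≈⟨ *-assoc _ _ _ ⟩
    ℤ→R N * (fallingℤ (N ℤ.- ℤ.1ℤ) k * ℤ→R (N ℤ.- ℤ.1ℤ ℤ.- + k))       ∎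

  binom-pascal : ∀ N k → binom N (suc k) ≈ binom (N ℤ.- ℤ.1ℤ) (suc k) + binom (N ℤ.- ℤ.1ℤ) k
  binom-pascal N k = begin
    fallingℤ N (suc k) * (n * K) ⁻¹               ≈⟨ *-cong (fallingℤ-suc N k) (⁻¹-distrib-* n≉0 (factorial-nonzero k)) ⟩
    (ℤ→R N * Fk) * (n ⁻¹ * K ⁻¹)                   ≈⟨ *-congʳ (*-congʳ N≈a+n) ⟩
    ((a + n) * Fk) * (n ⁻¹ * K ⁻¹)                 ≈⟨ expand a n Fk (n ⁻¹) (K ⁻¹) ⟩
    Fk * a * (n ⁻¹ * K ⁻¹) + Fk * K ⁻¹ * (n * n ⁻¹) ≈⟨ +-cong (*-congˡ (⁻¹-distrib-* n≉0 (factorial-nonzero k))) (*-congˡ (sym (⁻¹-inverseʳ n≉0))) ⟨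
    Fk * a * (n * K) ⁻¹ + Fk * K ⁻¹ * 1#            ≈⟨ +-congˡ (*-identityʳ _) ⟩
    Fk * a * (n * K) ⁻¹ + Fk * K ⁻¹                 ∎
    where
    Fk a n K : Carrier
    Fk = fallingℤ (N ℤ.- ℤ.1ℤ) k
    a  = ℤ→R (N ℤ.- ℤ.1ℤ ℤ.- + k)
    n  = ℕ→R R (suc k)
    K  = factorial k
    n≉0 : ¬ (n ≈ 0#)
    n≉0 = charZero k
    N≈a+n : ℤ→R N ≈ a + n
    N≈a+n = trans (reflexive (≡.cong ℤ→R (N≡[N-1-k]+[1+k] N (+ k)))) (ℤ→R-+ (N ℤ.- ℤ.1ℤ ℤ.- + k) (+ suc k))
    expand : ∀ a n f n⁻¹ K⁻¹ → ((a + n) * f) * (n⁻¹ * K⁻¹) ≈ f * a * (n⁻¹ * K⁻¹) + f * K⁻¹ * (n * n⁻¹)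
    expand = solve 5 (λ a n f n⁻¹ K⁻¹ → ((a :+ n) :* f) :* (n⁻¹ :* K⁻¹)
                                        := f :* a :* (n⁻¹ :* K⁻¹) :+ f :* K⁻¹ :* (n :* n⁻¹)) refl

  binom-zero : ∀ N → binom N 0 ≈ 1#
  binom-zero N = trans (*-identityˡ _) 1⁻¹≈1

  binom[n,1+n]≈0 : ∀ n → binom (+ n) (suc n) ≈ 0#
  binom[n,1+n]≈0 n = begin
    (fallingℤ (+ n) n * ℤ→R (+ n ℤ.- + n)) * factorial (suc n) ⁻¹
      ≡⟨ ≡.cong (λ t → (fallingℤ (+ n) n * ℤ→R t) * factorial (suc n) ⁻¹) (ℤP.+-inverseʳ (+ n)) ⟩
    (fallingℤ (+ n) n * 0#) * factorial (suc n) ⁻¹  ≈⟨ *-congʳ (zeroʳ _) ⟩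
    0# * factorial (suc n) ⁻¹                       ≈⟨ zeroˡ _ ⟩
    0#                                              ∎

  -- Iterated sums of a geometric sequence

  module IteratedGeometric (z u : Carrier) where

    -- Horner form of the sum in S-closed, so that S-step is a consequence of Pascal's rule.
    S : ℕ → ℤ → Carrier
    S zero    t = 0#
    S (suc n) t = u * (S n t + binom (t ℤ.- ℤ.1ℤ ℤ.+ + n) n)

    H : ℕ → ℤ → Carrier
    H n t = u ^ n * z ^ᶻ t − S n t

    S-step : ∀ n t → S (suc n) t ≈ S (suc n) (t ℤ.- ℤ.1ℤ) + S n t
    S-step zero    t = sym (+-identityʳ _)
    S-step (suc n) t = begin
      u * (S (suc n) t + binom N (suc n))
        ≈⟨ *-congˡ (+-cong (S-step n t) (binom-pascal N n)) ⟩
      u * ((S (suc n) (t ℤ.- ℤ.1ℤ) + S n t) + (binom (N ℤ.- ℤ.1ℤ) (suc n) + binom (N ℤ.- ℤ.1ℤ) n))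
        ≡⟨ ≡.cong₂ (λ i j → u * ((S (suc n) (t ℤ.- ℤ.1ℤ) + S n t) + (binom i (suc n) + binom j n)))
                   ([t-1+[1+k]]-1≡[t-1-1]+[1+k] t (+ n)) ([t-1+[1+k]]-1≡t-1+k t (+ n)) ⟩
      u * ((S (suc n) (t ℤ.- ℤ.1ℤ) + S n t)
           + (binom (t ℤ.- ℤ.1ℤ ℤ.- ℤ.1ℤ ℤ.+ + suc n) (suc n) + binom (t ℤ.- ℤ.1ℤ ℤ.+ + n) n))
        ≈⟨ regroup u _ _ _ _ ⟩
      u * (S (suc n) (t ℤ.- ℤ.1ℤ) + binom (t ℤ.- ℤ.1ℤ ℤ.- ℤ.1ℤ ℤ.+ + suc n) (suc n))
        + u * (S n t + binom (t ℤ.- ℤ.1ℤ ℤ.+ + n) n) ∎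
      where
      N : ℤ
      N = t ℤ.- ℤ.1ℤ ℤ.+ + suc n
      regroup : ∀ u A B C D → u * ((A + B) + (C + D)) ≈ u * (A + C) + u * (B + D)
      regroup = solve 5 (λ u A B C D → u :* ((A :+ B) :+ (C :+ D)) := u :* (A :+ C) :+ u :* (B :+ D)) refl

    S-at-0 : ∀ n → S (suc n) ℤ.0ℤ ≈ u ^ suc n
    S-at-0 zero    = *-congˡ (trans (+-identityˡ _) (binom-zero ℤ.0ℤ))
    S-at-0 (suc n) = *-congˡ (trans (+-cong (S-at-0 n) (binom[n,1+n]≈0 n)) (+-identityʳ _))

    S-closed : ∀ n t → S n t ≈ Σ< n (λ k → binom (t ℤ.- ℤ.1ℤ ℤ.+ + k) k * u ^ (n ℕ.∸ k))
    S-closed zero    t = refl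
    S-closed (suc n) t = begin
      u * (S n t + b n)                              ≈⟨ *-congˡ (+-congʳ (S-closed n t)) ⟩
      u * (Σ< n f + b n)                             ≈⟨ distribˡ u _ _ ⟩
      u * Σ< n f + u * b n                           ≈⟨ +-cong (*-distribˡ-Σ< n u f) (*-comm u (b n)) ⟩
      Σ< n (λ k → u * f k) + b n * u                 ≈⟨ +-cong (Σ<-cong n (λ k k<n → shift k (ℕP.<⇒≤ k<n)))
                                                                (*-congˡ (sym (*-identityʳ u))) ⟩
      Σ< n (λ k → b k * u ^ (suc n ℕ.∸ k)) + b n * u ^ 1
        ≡⟨ ≡.cong (λ e → Σ< n (λ k → b k * u ^ (suc n ℕ.∸ k)) + b n * u ^ e) (ℕP.m+n∸n≡m 1 n) ⟨
      Σ< (suc n) (λ k → b k * u ^ (suc n ℕ.∸ k))     ∎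
      where
      b : ℕ → Carrier
      b k = binom (t ℤ.- ℤ.1ℤ ℤ.+ + k) k
      f : ℕ → Carrier
      f k = b k * u ^ (n ℕ.∸ k)
      shift : ∀ k → k ℕ.≤ n → u * f k ≈ b k * u ^ (suc n ℕ.∸ k)
      shift k k≤n = begin
        u * (b k * u ^ (n ℕ.∸ k))       ≈⟨ x*[y*z]≈y*[x*z] u (b k) _ ⟩
        b k * u ^ suc (n ℕ.∸ k)         ≡⟨ ≡.cong (λ e → b k * u ^ e) (ℕP.+-∸-assoc 1 k≤n) ⟨
        b k * u ^ (suc n ℕ.∸ k)         ∎

    module _ (z≉0 : ¬ (z ≈ 0#)) (u[z-1]≈z : u * (z − 1#) ≈ z) where

      H-at-0 : ∀ n → H (suc n) ℤ.0ℤ ≈ 0#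
      H-at-0 n = trans (+-cong (*-identityʳ _) (-‿cong (S-at-0 n))) (-‿inverseʳ _)

      H-step : ∀ n t → H (suc n) t ≈ H (suc n) (t ℤ.- ℤ.1ℤ) + H n t
      H-step n t = begin
        u * uⁿ * z ^ᶻ t − S (suc n) t
          ≡⟨ ≡.cong (λ i → u * uⁿ * z ^ᶻ i − S (suc n) t) (1+[t-1]≡t t) ⟨
        u * uⁿ * z ^ᶻ ℤ.suc (t ℤ.- ℤ.1ℤ) − S (suc n) t
          ≈⟨ +-cong (*-congˡ (^ᶻ-suc z≉0 (t ℤ.- ℤ.1ℤ))) (-‿cong (S-step n t)) ⟩
        u * uⁿ * (z * Z) − (S (suc n) (t ℤ.- ℤ.1ℤ) + S n t)
          ≈⟨ +-congʳ (*-congʳ (*-comm u uⁿ)) ⟩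
        uⁿ * u * (z * Z) − (S (suc n) (t ℤ.- ℤ.1ℤ) + S n t)
          ≈⟨ +-congʳ (split uⁿ u z Z) ⟩
        (uⁿ * (u * (z − 1#)) * Z + uⁿ * u * Z) − (S (suc n) (t ℤ.- ℤ.1ℤ) + S n t)
          ≈⟨ +-congʳ (+-congʳ (*-congʳ (*-congˡ u[z-1]≈z))) ⟩
        (uⁿ * z * Z + uⁿ * u * Z) − (S (suc n) (t ℤ.- ℤ.1ℤ) + S n t)
          ≈⟨ regroup uⁿ u z Z _ _ ⟩
        (u * uⁿ * Z − S (suc n) (t ℤ.- ℤ.1ℤ)) + (uⁿ * (z * Z) − S n t)
          ≈⟨ +-congˡ (+-congʳ (*-congˡ (^ᶻ-suc z≉0 (t ℤ.- ℤ.1ℤ)))) ⟨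
        (u * uⁿ * Z − S (suc n) (t ℤ.- ℤ.1ℤ)) + (uⁿ * z ^ᶻ ℤ.suc (t ℤ.- ℤ.1ℤ) − S n t)
          ≡⟨ ≡.cong (λ i → (u * uⁿ * Z − S (suc n) (t ℤ.- ℤ.1ℤ)) + (uⁿ * z ^ᶻ i − S n t)) (1+[t-1]≡t t) ⟩
        H (suc n) (t ℤ.- ℤ.1ℤ) + H n t ∎
        where
        uⁿ Z : Carrier
        uⁿ = u ^ n
        Z  = z ^ᶻ (t ℤ.- ℤ.1ℤ)
        split : ∀ U u z Z → U * u * (z * Z) ≈ U * (u * (z − 1#)) * Z + U * u * Z
        split = solve 4 (λ U u z Z → U :* u :* (z :* Z) := U :* (u :* (z :- con ℤ.1ℤ)) :* Z :+ U :* u :* Z) refl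
        regroup : ∀ U u z Z A B → (U * z * Z + U * u * Z) − (A + B) ≈ (u * U * Z − A) + (U * (z * Z) − B)
        regroup = solve 6 (λ U u z Z A B → (U :* z :* Z :+ U :* u :* Z) :- (A :+ B)
                                           := (u :* U :* Z :- A) :+ (U :* (z :* Z) :- B)) refl

      iterSum-geometric : ∀ n c₀ x →
        iterSum n c₀ (z ^ᶻ_) x ≈ z ^ᶻ (c₀ ℤ.- ℤ.1ℤ) * H n (x ℤ.- (c₀ ℤ.- ℤ.1ℤ))
      iterSum-geometric zero    c₀ x = sym (begin
        z ^ᶻ c₁ * (1# * z ^ᶻ (x ℤ.- c₁) − 0#)  ≈⟨ *-congˡ (trans (+-cong (*-identityˡ _) -0#≈0#) (+-identityʳ _)) ⟩
        z ^ᶻ c₁ * z ^ᶻ (x ℤ.- c₁)              ≈⟨ ^ᶻ-homo-* z≉0 c₁ (x ℤ.- c₁) ⟨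
        z ^ᶻ (c₁ ℤ.+ (x ℤ.- c₁))               ≡⟨ ≡.cong (z ^ᶻ_) (c+[x-c]≡x c₁ x) ⟩
        z ^ᶻ x                                 ∎)
        where
        c₁ : ℤ
        c₁ = c₀ ℤ.- ℤ.1ℤ
      iterSum-geometric (suc n) c₀   = Σℤ-unique c₀ vanishes step
        where
        c₁ : ℤ
        c₁ = c₀ ℤ.- ℤ.1ℤ
        vanishes : z ^ᶻ c₁ * H (suc n) (c₁ ℤ.- c₁) ≈ 0#
        vanishes = begin
          z ^ᶻ c₁ * H (suc n) (c₁ ℤ.- c₁)  ≡⟨ ≡.cong (λ t → z ^ᶻ c₁ * H (suc n) t) (ℤP.+-inverseʳ c₁) ⟩
          z ^ᶻ c₁ * H (suc n) ℤ.0ℤ         ≈⟨ *-congˡ (H-at-0 n) ⟩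
          z ^ᶻ c₁ * 0#                     ≈⟨ zeroʳ _ ⟩
          0#                               ∎
        step : ∀ y → z ^ᶻ c₁ * H (suc n) (y ℤ.- c₁)
                     ≈ z ^ᶻ c₁ * H (suc n) (y ℤ.- ℤ.1ℤ ℤ.- c₁) + iterSum n c₀ (z ^ᶻ_) y
        step y = begin
          z ^ᶻ c₁ * H (suc n) (y ℤ.- c₁)
            ≈⟨ *-congˡ (H-step n (y ℤ.- c₁)) ⟩
          z ^ᶻ c₁ * (H (suc n) (y ℤ.- c₁ ℤ.- ℤ.1ℤ) + H n (y ℤ.- c₁))
            ≈⟨ distribˡ _ _ _ ⟩
          z ^ᶻ c₁ * H (suc n) (y ℤ.- c₁ ℤ.- ℤ.1ℤ) + z ^ᶻ c₁ * H n (y ℤ.- c₁)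
            ≡⟨ ≡.cong (λ t → z ^ᶻ c₁ * H (suc n) t + z ^ᶻ c₁ * H n (y ℤ.- c₁)) (x-1-c≡x-c-1 y c₁) ⟨
          z ^ᶻ c₁ * H (suc n) (y ℤ.- ℤ.1ℤ ℤ.- c₁) + z ^ᶻ c₁ * H n (y ℤ.- c₁)
            ≈⟨ +-congˡ (iterSum-geometric n c₀ y) ⟨
          z ^ᶻ c₁ * H (suc n) (y ℤ.- ℤ.1ℤ ℤ.- c₁) + iterSum n c₀ (z ^ᶻ_) y ∎

  -- Binet forms of Horadam sequences

  module Binet (p q Δ : Carrier) (q≉0 : ¬ (q ≈ 0#))
               (Δ²≈p²-4q : Δ * Δ ≈ p * p − ℕ→R R 4 * q) (p²-4q≉0 : ¬ (p * p − ℕ→R R 4 * q ≈ 0#)) where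

    Δ≉0 : ¬ (Δ ≈ 0#)
    Δ≉0 Δ≈0 = p²-4q≉0 (trans (sym Δ²≈p²-4q) (trans (*-congʳ Δ≈0) (zeroˡ Δ)))

    ½ : Carrier
    ½ = ℕ→R R 2 ⁻¹

    2*½≈1 : ℕ→R R 2 * ½ ≈ 1#
    2*½≈1 = ⁻¹-inverseʳ (charZero 1)

    τ σ : Carrier
    τ = (p + Δ) * ½
    σ = (p − Δ) * ½

    τ+σ≈p : τ + σ ≈ p
    τ+σ≈p = begin
      (p + Δ) * ½ + (p − Δ) * ½   ≈⟨ expand p Δ ½ ⟩
      p * (ℕ→R R 2 * ½)           ≈⟨ *-congˡ 2*½≈1 ⟩
      p * 1#                      ≈⟨ *-identityʳ p ⟩
      p                           ∎
      where
      expand : ∀ p Δ h → (p + Δ) * h + (p − Δ) * h ≈ p * ((1# + (1# + 0#)) * h)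
      expand = solve 3 (λ p Δ h → (p :+ Δ) :* h :+ (p :- Δ) :* h
                                  := p :* ((con ℤ.1ℤ :+ (con ℤ.1ℤ :+ con ℤ.0ℤ)) :* h)) refl

    τ-σ≈Δ : τ − σ ≈ Δ
    τ-σ≈Δ = begin
      (p + Δ) * ½ − (p − Δ) * ½   ≈⟨ expand p Δ ½ ⟩
      Δ * (ℕ→R R 2 * ½)           ≈⟨ *-congˡ 2*½≈1 ⟩
      Δ * 1#                      ≈⟨ *-identityʳ Δ ⟩
      Δ                           ∎
      where
      expand : ∀ p Δ h → (p + Δ) * h − (p − Δ) * h ≈ Δ * ((1# + (1# + 0#)) * h)
      expand = solve 3 (λ p Δ h → (p :+ Δ) :* h :- (p :- Δ) :* h
                                  := Δ :* ((con ℤ.1ℤ :+ (con ℤ.1ℤ :+ con ℤ.0ℤ)) :* h)) refl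

    τ*σ≈q : τ * σ ≈ q
    τ*σ≈q = begin
      (p + Δ) * ½ * ((p − Δ) * ½)               ≈⟨ expand p Δ ½ ⟩
      (p * p − Δ * Δ) * (½ * ½)                 ≈⟨ *-congʳ (+-congˡ (-‿cong Δ²≈p²-4q)) ⟩
      (p * p − (p * p − ℕ→R R 4 * q)) * (½ * ½) ≈⟨ simplify p q ½ ⟩
      q * ((ℕ→R R 2 * ½) * (ℕ→R R 2 * ½))       ≈⟨ *-congˡ (*-cong 2*½≈1 2*½≈1) ⟩
      q * (1# * 1#)                             ≈⟨ *-congˡ (*-identityʳ 1#) ⟩
      q * 1#                                    ≈⟨ *-identityʳ q ⟩
      q                                         ∎
      where
      expand : ∀ p Δ h → (p + Δ) * h * ((p − Δ) * h) ≈ (p * p − Δ * Δ) * (h * h)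
      expand = solve 3 (λ p Δ h → (p :+ Δ) :* h :* ((p :- Δ) :* h) := (p :* p :- Δ :* Δ) :* (h :* h)) refl
      simplify : ∀ p q h → (p * p − (p * p − (1# + (1# + (1# + (1# + 0#)))) * q)) * (h * h)
                           ≈ q * (((1# + (1# + 0#)) * h) * ((1# + (1# + 0#)) * h))
      simplify = solve 3 (λ p q h →
        (p :* p :- (p :* p :- (con ℤ.1ℤ :+ (con ℤ.1ℤ :+ (con ℤ.1ℤ :+ (con ℤ.1ℤ :+ con ℤ.0ℤ)))) :* q)) :* (h :* h)
        := q :* (((con ℤ.1ℤ :+ (con ℤ.1ℤ :+ con ℤ.0ℤ)) :* h) :* ((con ℤ.1ℤ :+ (con ℤ.1ℤ :+ con ℤ.0ℤ)) :* h))) refl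

    τ≉0 : ¬ (τ ≈ 0#)
    τ≉0 τ≈0 = q≉0 (trans (sym τ*σ≈q) (trans (*-congʳ τ≈0) (zeroˡ σ)))

    σ≉0 : ¬ (σ ≈ 0#)
    σ≉0 σ≈0 = q≉0 (trans (sym τ*σ≈q) (trans (*-congˡ σ≈0) (zeroʳ τ)))

    x²≈px-q : ∀ {x y} → x + y ≈ p → x * y ≈ q → x * x ≈ p * x − q
    x²≈px-q {x} {y} x+y≈p xy≈q = begin
      x * x                ≈⟨ expand x y ⟩
      (x + y) * x − x * y  ≈⟨ +-cong (*-congʳ x+y≈p) (-‿cong xy≈q) ⟩
      p * x − q            ∎
      where
      expand : ∀ x y → x * x ≈ (x + y) * x − x * y
      expand = solve 2 (λ x y → x :* x := (x :+ y) :* x :- x :* y) refl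

    τ²≈pτ-q : τ * τ ≈ p * τ − q
    τ²≈pτ-q = x²≈px-q τ+σ≈p τ*σ≈q

    σ²≈pσ-q : σ * σ ≈ p * σ − q
    σ²≈pσ-q = x²≈px-q (trans (+-comm σ τ) τ+σ≈p) (trans (*-comm σ τ) τ*σ≈q)

    module _ (a b : Carrier) where

      A B : Carrier
      A = (b − a * σ) * Δ ⁻¹
      B = (a * τ − b) * Δ ⁻¹

      binetForm : ℤ → Carrier
      binetForm k = A * τ ^ᶻ k + B * σ ^ᶻ k

      binetForm-recurrence : ∀ k → binetForm (ℤ.suc (ℤ.suc k)) ≈ p * binetForm (ℤ.suc k) − q * binetForm k
      binetForm-recurrence k = begin
        A * τ ^ᶻ ℤ.suc (ℤ.suc k) + B * σ ^ᶻ ℤ.suc (ℤ.suc k)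
          ≈⟨ +-cong (*-congˡ (^ᶻ-suc-suc τ≉0 k)) (*-congˡ (^ᶻ-suc-suc σ≉0 k)) ⟩
        A * ((τ * τ) * T) + B * ((σ * σ) * S)
          ≈⟨ +-cong (*-congˡ (*-congʳ τ²≈pτ-q)) (*-congˡ (*-congʳ σ²≈pσ-q)) ⟩
        A * ((p * τ − q) * T) + B * ((p * σ − q) * S)
          ≈⟨ regroup p q τ σ A B T S ⟩
        p * (A * (τ * T) + B * (σ * S)) − q * (A * T + B * S)
          ≈⟨ +-congʳ (*-congˡ (+-cong (*-congˡ (^ᶻ-suc τ≉0 k)) (*-congˡ (^ᶻ-suc σ≉0 k)))) ⟨
        p * binetForm (ℤ.suc k) − q * binetForm k ∎
        where
        T S : Carrier
        T = τ ^ᶻ k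
        S = σ ^ᶻ k
        regroup : ∀ p q τ σ A B T S → A * ((p * τ − q) * T) + B * ((p * σ − q) * S)
                                      ≈ p * (A * (τ * T) + B * (σ * S)) − q * (A * T + B * S)
        regroup = solve 8 (λ p q τ σ A B T S → A :* ((p :* τ :- q) :* T) :+ B :* ((p :* σ :- q) :* S)
                                              := p :* (A :* (τ :* T) :+ B :* (σ :* S)) :- q :* (A :* T :+ B :* S)) refl

      binetForm-backward : ∀ k → (p * binetForm (ℤ.suc k) − binetForm (ℤ.suc (ℤ.suc k))) / q ≈ binetForm k
      binetForm-backward k = begin
        (p * W₁ − binetForm (ℤ.suc (ℤ.suc k))) * q ⁻¹   ≈⟨ *-congʳ (+-congˡ (-‿cong (binetForm-recurrence k))) ⟩
        (p * W₁ − (p * W₁ − q * W₀)) * q ⁻¹             ≈⟨ cancel (p * W₁) q W₀ (q ⁻¹) ⟩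
        W₀ * (q * q ⁻¹)                                 ≈⟨ *-congˡ (⁻¹-inverseʳ q≉0) ⟩
        W₀ * 1#                                         ≈⟨ *-identityʳ W₀ ⟩
        W₀                                              ∎
        where
        W₀ W₁ : Carrier
        W₀ = binetForm k
        W₁ = binetForm (ℤ.suc k)
        cancel : ∀ P q W q⁻¹ → (P − (P − q * W)) * q⁻¹ ≈ W * (q * q⁻¹)
        cancel = solve 4 (λ P q W q⁻¹ → (P :- (P :- q :* W)) :* q⁻¹ := W :* (q :* q⁻¹)) refl

      binetForm-0 : binetForm ℤ.0ℤ ≈ a
      binetForm-0 = begin
        (b − a * σ) * Δ ⁻¹ * 1# + (a * τ − b) * Δ ⁻¹ * 1#  ≈⟨ expand a b τ σ (Δ ⁻¹) ⟩
        a * ((τ − σ) * Δ ⁻¹)                               ≈⟨ *-congˡ (trans (*-congʳ τ-σ≈Δ) (⁻¹-inverseʳ Δ≉0)) ⟩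
        a * 1#                                             ≈⟨ *-identityʳ a ⟩
        a                                                  ∎
        where
        expand : ∀ a b τ σ i → (b − a * σ) * i * 1# + (a * τ − b) * i * 1# ≈ a * ((τ − σ) * i)
        expand = solve 5 (λ a b τ σ i → (b :- a :* σ) :* i :* con ℤ.1ℤ :+ (a :* τ :- b) :* i :* con ℤ.1ℤ
                                        := a :* ((τ :- σ) :* i)) refl

      binetForm-1 : binetForm ℤ.1ℤ ≈ b
      binetForm-1 = begin
        (b − a * σ) * Δ ⁻¹ * (τ * 1#) + (a * τ − b) * Δ ⁻¹ * (σ * 1#)  ≈⟨ expand a b τ σ (Δ ⁻¹) ⟩
        b * ((τ − σ) * Δ ⁻¹)                                           ≈⟨ *-congˡ (trans (*-congʳ τ-σ≈Δ) (⁻¹-inverseʳ Δ≉0)) ⟩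
        b * 1#                                                         ≈⟨ *-identityʳ b ⟩
        b                                                              ∎
        where
        expand : ∀ a b τ σ i → (b − a * σ) * i * (τ * 1#) + (a * τ − b) * i * (σ * 1#) ≈ b * ((τ − σ) * i)
        expand = solve 5 (λ a b τ σ i → (b :- a :* σ) :* i :* (τ :* con ℤ.1ℤ) :+ (a :* τ :- b) :* i :* (σ :* con ℤ.1ℤ)
                                        := b :* ((τ :- σ) :* i)) refl

      iterate-fwd : ∀ n → proj₁ (iterate (fwd p q) n (a , b)) ≈ binetForm (+ n)
                        × proj₂ (iterate (fwd p q) n (a , b)) ≈ binetForm (+ suc n)
      iterate-fwd zero    = sym binetForm-0 , sym binetForm-1
      iterate-fwd (suc n) = let Wₙ≈ , Wₙ₊₁≈ = iterate-fwd n in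
        Wₙ₊₁≈ , trans (+-cong (*-congˡ Wₙ₊₁≈) (-‿cong (*-congˡ Wₙ≈))) (sym (binetForm-recurrence (+ n)))

      iterate-bwd : ∀ n → proj₁ (iterate (bwd p q) n (a , b)) ≈ binetForm (ℤ.- + n)
                        × proj₂ (iterate (bwd p q) n (a , b)) ≈ binetForm (ℤ.suc (ℤ.- + n))
      iterate-bwd zero    = iterate-fwd 0
      iterate-bwd (suc n) = let W₋ₙ≈ , W₁₋ₙ≈ = iterate-bwd n in
        (begin
          (p * proj₁ (iterate (bwd p q) n (a , b)) − proj₂ (iterate (bwd p q) n (a , b))) / q
            ≈⟨ *-congʳ (+-cong (*-congˡ W₋ₙ≈) (-‿cong W₁₋ₙ≈)) ⟩
          (p * binetForm (ℤ.- + n) − binetForm (ℤ.suc (ℤ.- + n))) / q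
            ≡⟨ ≡.cong (λ k → (p * binetForm k − binetForm (ℤ.suc k)) / q) (suc-[1+n]≡-n n) ⟨
          (p * binetForm (ℤ.suc -[1+ n ]) − binetForm (ℤ.suc (ℤ.suc -[1+ n ]))) / q
            ≈⟨ binetForm-backward -[1+ n ] ⟩
          binetForm -[1+ n ] ∎)
        , trans W₋ₙ≈ (reflexive (≡.cong binetForm (≡.sym (suc-[1+n]≡-n n))))

    W-Binet : ∀ a b k → W a b p q k ≈ binetForm a b k
    W-Binet a b (+ n)    = proj₁ (iterate-fwd a b n)
    W-Binet a b -[1+ n ] = proj₁ (iterate-bwd a b (suc n))

    U-Binet : ∀ k → U p q k * Δ ≈ τ ^ᶻ k − σ ^ᶻ k
    U-Binet k = begin
      U p q k * Δ                                               ≈⟨ *-congʳ (W-Binet 0# 1# k) ⟩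
      ((1# − 0# * σ) * Δ ⁻¹ * T + (0# * τ − 1#) * Δ ⁻¹ * S) * Δ ≈⟨ expand τ σ Δ (Δ ⁻¹) T S ⟩
      (T − S) * (Δ * Δ ⁻¹)                                      ≈⟨ *-congˡ (⁻¹-inverseʳ Δ≉0) ⟩
      (T − S) * 1#                                              ≈⟨ *-identityʳ _ ⟩
      T − S                                                     ∎
      where
      T S : Carrier
      T = τ ^ᶻ k
      S = σ ^ᶻ k
      expand : ∀ τ σ Δ i T S → ((1# − 0# * σ) * i * T + (0# * τ − 1#) * i * S) * Δ ≈ (T − S) * (Δ * i)
      expand = solve 6 (λ τ σ Δ i T S → ((con ℤ.1ℤ :- con ℤ.0ℤ :* σ) :* i :* T :+ (con ℤ.0ℤ :* τ :- con ℤ.1ℤ) :* i :* S) :* Δ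
                                        := (T :- S) :* (Δ :* i)) refl

    V-Binet : ∀ k → V p q k ≈ τ ^ᶻ k + σ ^ᶻ k
    V-Binet k = begin
      V p q k                                                     ≈⟨ W-Binet (ℕ→R R 2) p k ⟩
      (p − ℕ→R R 2 * σ) * Δ ⁻¹ * T + (ℕ→R R 2 * τ − p) * Δ ⁻¹ * S ≈⟨ +-cong (*-congʳ A≈1) (*-congʳ B≈1) ⟩
      1# * T + 1# * S                                             ≈⟨ +-cong (*-identityˡ T) (*-identityˡ S) ⟩
      T + S                                                       ∎
      where
      T S : Carrier
      T = τ ^ᶻ k
      S = σ ^ᶻ k
      Δ*Δ⁻¹≈1 : Δ * Δ ⁻¹ ≈ 1#
      Δ*Δ⁻¹≈1 = ⁻¹-inverseʳ Δ≉0
      A≈1 : (p − ℕ→R R 2 * σ) * Δ ⁻¹ ≈ 1#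
      A≈1 = begin
        (p − ℕ→R R 2 * σ) * Δ ⁻¹        ≈⟨ *-congʳ (+-congʳ τ+σ≈p) ⟨
        ((τ + σ) − ℕ→R R 2 * σ) * Δ ⁻¹  ≈⟨ *-congʳ (simplify τ σ) ⟩
        (τ − σ) * Δ ⁻¹                  ≈⟨ trans (*-congʳ τ-σ≈Δ) Δ*Δ⁻¹≈1 ⟩
        1#                              ∎
        where
        simplify : ∀ τ σ → (τ + σ) − (1# + (1# + 0#)) * σ ≈ τ − σ
        simplify = solve 2 (λ τ σ → (τ :+ σ) :- (con ℤ.1ℤ :+ (con ℤ.1ℤ :+ con ℤ.0ℤ)) :* σ := τ :- σ) refl
      B≈1 : (ℕ→R R 2 * τ − p) * Δ ⁻¹ ≈ 1#
      B≈1 = begin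
        (ℕ→R R 2 * τ − p) * Δ ⁻¹        ≈⟨ *-congʳ (+-congˡ (-‿cong τ+σ≈p)) ⟨
        (ℕ→R R 2 * τ − (τ + σ)) * Δ ⁻¹  ≈⟨ *-congʳ (simplify τ σ) ⟩
        (τ − σ) * Δ ⁻¹                  ≈⟨ trans (*-congʳ τ-σ≈Δ) Δ*Δ⁻¹≈1 ⟩
        1#                              ∎
        where
        simplify : ∀ τ σ → (1# + (1# + 0#)) * τ − (τ + σ) ≈ τ − σ
        simplify = solve 2 (λ τ σ → (con ℤ.1ℤ :+ (con ℤ.1ℤ :+ con ℤ.0ℤ)) :* τ :- (τ :+ σ) := τ :- σ) refl

    X-Binet : ∀ a b k → W a b p q (k ℤ.+ ℤ.1ℤ) − q * W a b p q (k ℤ.- ℤ.1ℤ)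
                        ≈ Δ * (A a b * τ ^ᶻ k − B a b * σ ^ᶻ k)
    X-Binet a b k = begin
      W a b p q (k ℤ.+ ℤ.1ℤ) − q * W a b p q k′
        ≈⟨ +-cong (W-Binet a b (k ℤ.+ ℤ.1ℤ)) (-‿cong (*-congˡ (W-Binet a b k′))) ⟩
      binetForm a b (k ℤ.+ ℤ.1ℤ) − q * binetForm a b k′
        ≡⟨ ≡.cong (λ j → binetForm a b j − q * binetForm a b k′) (k+1≡1+[1+[k-1]] k) ⟩
      binetForm a b (ℤ.suc (ℤ.suc k′)) − q * binetForm a b k′
        ≈⟨ +-cong (+-cong (*-congˡ (^ᶻ-suc-suc τ≉0 k′)) (*-congˡ (^ᶻ-suc-suc σ≉0 k′))) (-‿cong (*-congʳ (sym τ*σ≈q))) ⟩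
      (A′ * ((τ * τ) * T) + B′ * ((σ * σ) * S)) − (τ * σ) * (A′ * T + B′ * S)
        ≈⟨ factor τ σ A′ B′ T S ⟩
      (τ − σ) * (A′ * (τ * T) − B′ * (σ * S))
        ≈⟨ *-cong τ-σ≈Δ (+-cong (*-congˡ (sym (^ᶻ-suc τ≉0 k′))) (-‿cong (*-congˡ (sym (^ᶻ-suc σ≉0 k′))))) ⟩
      Δ * (A′ * τ ^ᶻ ℤ.suc k′ − B′ * σ ^ᶻ ℤ.suc k′)
        ≡⟨ ≡.cong (λ j → Δ * (A′ * τ ^ᶻ j − B′ * σ ^ᶻ j)) (1+[t-1]≡t k) ⟩
      Δ * (A′ * τ ^ᶻ k − B′ * σ ^ᶻ k) ∎
      where
      k′ : ℤ
      k′ = k ℤ.- ℤ.1ℤ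
      A′ B′ T S : Carrier
      A′ = A a b
      B′ = B a b
      T  = τ ^ᶻ k′
      S  = σ ^ᶻ k′
      factor : ∀ τ σ A B T S → (A * ((τ * τ) * T) + B * ((σ * σ) * S)) − (τ * σ) * (A * T + B * S)
                               ≈ (τ − σ) * (A * (τ * T) − B * (σ * S))
      factor = solve 6 (λ τ σ A B T S → (A :* ((τ :* τ) :* T) :+ B :* ((σ :* σ) :* S)) :- (τ :* σ) :* (A :* T :+ B :* S)
                                        := (τ :- σ) :* (A :* (τ :* T) :- B :* (σ :* S))) refl

    signedBinetForm : Carrier → Carrier → ℕ → ℤ → Carrier
    signedBinetForm a b e k = A a b * τ ^ᶻ k + (- 1#) ^ e * (B a b * σ ^ᶻ k)

    signedBinetForm-even : ∀ a b i k → signedBinetForm a b (2 ℕ.* i) k ≈ W a b p q k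
    signedBinetForm-even a b i k =
      trans (+-congˡ (trans (*-congʳ ([-1]^[2n]≈1 i)) (*-identityˡ _))) (sym (W-Binet a b k))

    signedBinetForm-odd : ∀ a b i k → signedBinetForm a b (2 ℕ.* i ℕ.+ 1) k
                                      ≈ (W a b p q (k ℤ.+ ℤ.1ℤ) − q * W a b p q (k ℤ.- ℤ.1ℤ)) * Δ ⁻¹
    signedBinetForm-odd a b i k = begin
      A′ * T + (- 1#) ^ (2 ℕ.* i ℕ.+ 1) * (B′ * S)  ≈⟨ +-congˡ (*-congʳ ([-1]^[2n+1]≈-1 i)) ⟩
      A′ * T + - 1# * (B′ * S)                      ≈⟨ expand A′ T B′ S Δ (Δ ⁻¹) ⟩
      Δ * (A′ * T − B′ * S) * Δ ⁻¹ + (A′ * T − B′ * S) * (1# − Δ * Δ ⁻¹)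
        ≈⟨ +-congˡ (*-congˡ (trans (+-congˡ (-‿cong (⁻¹-inverseʳ Δ≉0))) (-‿inverseʳ 1#))) ⟩
      Δ * (A′ * T − B′ * S) * Δ ⁻¹ + (A′ * T − B′ * S) * 0#
        ≈⟨ trans (+-congˡ (zeroʳ _)) (+-identityʳ _) ⟩
      Δ * (A′ * T − B′ * S) * Δ ⁻¹                  ≈⟨ *-congʳ (X-Binet a b k) ⟨
      (W a b p q (k ℤ.+ ℤ.1ℤ) − q * W a b p q (k ℤ.- ℤ.1ℤ)) * Δ ⁻¹ ∎
      where
      A′ B′ T S : Carrier
      A′ = A a b
      B′ = B a b
      T  = τ ^ᶻ k
      S  = σ ^ᶻ k
      expand : ∀ A T B S Δ i → A * T + - 1# * (B * S) ≈ Δ * (A * T − B * S) * i + (A * T − B * S) * (1# − Δ * i)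
      expand = solve 6 (λ A T B S Δ i → A :* T :+ :- con ℤ.1ℤ :* (B :* S)
                                        := Δ :* (A :* T :- B :* S) :* i :+ (A :* T :- B :* S) :* (con ℤ.1ℤ :- Δ :* i)) refl

    -- The iterated sum of ρᵃ W (r a + s)

    module IteratedSum (a b : Carrier) (r s c₀ d : ℤ) (Uᵣ≉0 : ¬ (U p q r ≈ 0#))
                (Vd≉0 : ¬ (V p q d ≈ 0#)) (Vr+d≉0 : ¬ (V p q (r ℤ.+ d) ≈ 0#)) where

      ρ κ θ : Carrier
      ρ = V p q d / V p q (r ℤ.+ d)
      κ = V p q d / U p q r
      θ = κ * ((q ^ᶻ d) ⁻¹ * Δ ⁻¹)

      c₁ : ℤ
      c₁ = c₀ ℤ.- ℤ.1ℤ

      g : ℤ → Carrier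
      g a₀ = ρ ^ᶻ a₀ * W a b p q (r ℤ.* a₀ ℤ.+ s)

      X : ℤ → Carrier
      X k = W a b p q (k ℤ.+ ℤ.1ℤ) − q * W a b p q (k ℤ.- ℤ.1ℤ)

      idx : ℤ → ℕ → ℤ
      idx y e = (r ℤ.+ d) ℤ.* + e ℤ.+ r ℤ.* y ℤ.+ s

      ρ≉0 : ¬ (ρ ≈ 0#)
      ρ≉0 = *-nonzero Vd≉0 (⁻¹-nonzero Vr+d≉0)

      -- For a root x with conjugate y, this is what makes z = ρ xʳ and u = θ x^(r+d) satisfy u (z - 1) = z.
      root-ratio : ∀ {x y} → ¬ (x ≈ 0#) → ¬ (y ≈ 0#) → x * y ≈ q →
                   V p q d ≈ x ^ᶻ d + y ^ᶻ d → V p q (r ℤ.+ d) ≈ x ^ᶻ (r ℤ.+ d) + y ^ᶻ (r ℤ.+ d) →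
                   κ * (q ^ᶻ d) ⁻¹ * x ^ᶻ (r ℤ.+ d) * (ρ * x ^ᶻ r − 1#)
                   ≈ ρ * x ^ᶻ r * ((x ^ᶻ r − y ^ᶻ r) * U p q r ⁻¹)
      root-ratio {x} {y} x≉0 y≉0 xy≈q Vd≈ Vr+d≈ = begin
        (Vd * Uᵣ ⁻¹) * Q⁻¹ * x ^ᶻ (r ℤ.+ d) * (Vd * Vr+d ⁻¹ * xʳ − 1#)
          ≈⟨ *-cong (*-congˡ (^ᶻ-homo-* x≉0 r d)) z-1≈ ⟩
        (Vd * Uᵣ ⁻¹) * Q⁻¹ * (xʳ * xᵈ) * (yᵈ * (xʳ − yʳ) * Vr+d ⁻¹)
          ≈⟨ regroup Vd (Uᵣ ⁻¹) Q⁻¹ xʳ xᵈ yᵈ (xʳ − yʳ) (Vr+d ⁻¹) ⟩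
        Vd * Vr+d ⁻¹ * xʳ * ((xʳ − yʳ) * Uᵣ ⁻¹) * ((xᵈ * yᵈ) * Q⁻¹)
          ≈⟨ *-congˡ xᵈyᵈQ⁻¹≈1 ⟩
        Vd * Vr+d ⁻¹ * xʳ * ((xʳ − yʳ) * Uᵣ ⁻¹) * 1#
          ≈⟨ *-identityʳ _ ⟩
        Vd * Vr+d ⁻¹ * xʳ * ((xʳ − yʳ) * Uᵣ ⁻¹) ∎
        where
        Vd Vr+d Uᵣ Q⁻¹ xʳ xᵈ yʳ yᵈ : Carrier
        Vd  = V p q d
        Vr+d = V p q (r ℤ.+ d)
        Uᵣ   = U p q r
        Q⁻¹  = (q ^ᶻ d) ⁻¹
        xʳ   = x ^ᶻ r
        xᵈ   = x ^ᶻ d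
        yʳ   = y ^ᶻ r
        yᵈ   = y ^ᶻ d
        z-1≈ : Vd * Vr+d ⁻¹ * xʳ − 1# ≈ yᵈ * (xʳ − yʳ) * Vr+d ⁻¹
        z-1≈ = begin
          Vd * Vr+d ⁻¹ * xʳ − 1#                             ≈⟨ +-cong (*-congʳ (*-congʳ Vd≈)) (-‿cong (sym (⁻¹-inverseʳ Vr+d≉0))) ⟩
          (xᵈ + yᵈ) * Vr+d ⁻¹ * xʳ − Vr+d * Vr+d ⁻¹          ≈⟨ +-congˡ (-‿cong (*-congʳ (trans Vr+d≈ (+-cong (^ᶻ-homo-* x≉0 r d) (^ᶻ-homo-* y≉0 r d))))) ⟩
          (xᵈ + yᵈ) * Vr+d ⁻¹ * xʳ − (xʳ * xᵈ + yʳ * yᵈ) * Vr+d ⁻¹ ≈⟨ factor xᵈ yᵈ (Vr+d ⁻¹) xʳ yʳ ⟩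
          yᵈ * (xʳ − yʳ) * Vr+d ⁻¹                             ∎
          where
          factor : ∀ xᵈ yᵈ v xʳ yʳ → (xᵈ + yᵈ) * v * xʳ − (xʳ * xᵈ + yʳ * yᵈ) * v ≈ yᵈ * (xʳ − yʳ) * v
          factor = solve 5 (λ xᵈ yᵈ v xʳ yʳ → (xᵈ :+ yᵈ) :* v :* xʳ :- (xʳ :* xᵈ :+ yʳ :* yᵈ) :* v
                                              := yᵈ :* (xʳ :- yʳ) :* v) refl
        xᵈyᵈQ⁻¹≈1 : (xᵈ * yᵈ) * Q⁻¹ ≈ 1#
        xᵈyᵈQ⁻¹≈1 = trans (*-congʳ (trans (sym (^ᶻ-distrib-* x≉0 y≉0 d)) (^ᶻ-congˡ xy≈q q≉0 d)))
                          (⁻¹-inverseʳ (^ᶻ-nonzero q≉0 d))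
        regroup : ∀ V i Q xʳ xᵈ yᵈ D w → V * i * Q * (xʳ * xᵈ) * (yᵈ * D * w) ≈ V * w * xʳ * (D * i) * ((xᵈ * yᵈ) * Q)
        regroup = solve 8 (λ V i Q xʳ xᵈ yᵈ D w → V :* i :* Q :* (xʳ :* xᵈ) :* (yᵈ :* D :* w)
                                                 := V :* w :* xʳ :* (D :* i) :* ((xᵈ :* yᵈ) :* Q)) refl

      z₁ u₁ z₂ u₂ : Carrier
      z₁ = ρ * τ ^ᶻ r
      u₁ = θ * τ ^ᶻ (r ℤ.+ d)
      z₂ = ρ * σ ^ᶻ r
      u₂ = - (θ * σ ^ᶻ (r ℤ.+ d))

      z₁≉0 : ¬ (z₁ ≈ 0#)
      z₁≉0 = *-nonzero ρ≉0 (^ᶻ-nonzero τ≉0 r)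

      z₂≉0 : ¬ (z₂ ≈ 0#)
      z₂≉0 = *-nonzero ρ≉0 (^ᶻ-nonzero σ≉0 r)

      cancel-UΔ : ∀ z → z * ((τ ^ᶻ r − σ ^ᶻ r) * U p q r ⁻¹) * Δ ⁻¹ ≈ z
      cancel-UΔ z = begin
        z * ((τ ^ᶻ r − σ ^ᶻ r) * U p q r ⁻¹) * Δ ⁻¹    ≈⟨ *-congʳ (*-congˡ (*-congʳ (U-Binet r))) ⟨
        z * ((U p q r * Δ) * U p q r ⁻¹) * Δ ⁻¹       ≈⟨ regroup z (U p q r) Δ (U p q r ⁻¹) (Δ ⁻¹) ⟩
        z * ((U p q r * U p q r ⁻¹) * (Δ * Δ ⁻¹))     ≈⟨ *-congˡ (*-cong (⁻¹-inverseʳ Uᵣ≉0) (⁻¹-inverseʳ Δ≉0)) ⟩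
        z * (1# * 1#)                                 ≈⟨ trans (*-congˡ (*-identityʳ 1#)) (*-identityʳ z) ⟩
        z                                             ∎
        where
        regroup : ∀ z U Δ U⁻¹ Δ⁻¹ → z * ((U * Δ) * U⁻¹) * Δ⁻¹ ≈ z * ((U * U⁻¹) * (Δ * Δ⁻¹))
        regroup = solve 5 (λ z U Δ U⁻¹ Δ⁻¹ → z :* ((U :* Δ) :* U⁻¹) :* Δ⁻¹ := z :* ((U :* U⁻¹) :* (Δ :* Δ⁻¹))) refl

      u₁[z₁-1]≈z₁ : u₁ * (z₁ − 1#) ≈ z₁
      u₁[z₁-1]≈z₁ = begin
        κ * ((q ^ᶻ d) ⁻¹ * Δ ⁻¹) * τ ^ᶻ (r ℤ.+ d) * (z₁ − 1#)
          ≈⟨ regroup κ ((q ^ᶻ d) ⁻¹) (Δ ⁻¹) (τ ^ᶻ (r ℤ.+ d)) (z₁ − 1#) ⟩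
        κ * (q ^ᶻ d) ⁻¹ * τ ^ᶻ (r ℤ.+ d) * (z₁ − 1#) * Δ ⁻¹
          ≈⟨ *-congʳ (root-ratio τ≉0 σ≉0 τ*σ≈q (V-Binet d) (V-Binet (r ℤ.+ d))) ⟩
        z₁ * ((τ ^ᶻ r − σ ^ᶻ r) * U p q r ⁻¹) * Δ ⁻¹
          ≈⟨ cancel-UΔ z₁ ⟩
        z₁ ∎
        where
        regroup : ∀ κ Q⁻¹ Δ⁻¹ T Z → κ * (Q⁻¹ * Δ⁻¹) * T * Z ≈ κ * Q⁻¹ * T * Z * Δ⁻¹
        regroup = solve 5 (λ κ Q⁻¹ Δ⁻¹ T Z → κ :* (Q⁻¹ :* Δ⁻¹) :* T :* Z := κ :* Q⁻¹ :* T :* Z :* Δ⁻¹) refl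

      u₂[z₂-1]≈z₂ : u₂ * (z₂ − 1#) ≈ z₂
      u₂[z₂-1]≈z₂ = begin
        - (κ * ((q ^ᶻ d) ⁻¹ * Δ ⁻¹) * σ ^ᶻ (r ℤ.+ d)) * (z₂ − 1#)
          ≈⟨ regroup κ ((q ^ᶻ d) ⁻¹) (Δ ⁻¹) (σ ^ᶻ (r ℤ.+ d)) (z₂ − 1#) ⟩
        - (κ * (q ^ᶻ d) ⁻¹ * σ ^ᶻ (r ℤ.+ d) * (z₂ − 1#) * Δ ⁻¹)
          ≈⟨ -‿cong (*-congʳ (root-ratio σ≉0 τ≉0 (trans (*-comm σ τ) τ*σ≈q)
                                 (trans (V-Binet d) (+-comm _ _)) (trans (V-Binet (r ℤ.+ d)) (+-comm _ _)))) ⟩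
        - (z₂ * ((σ ^ᶻ r − τ ^ᶻ r) * U p q r ⁻¹) * Δ ⁻¹)
          ≈⟨ flip z₂ (σ ^ᶻ r) (τ ^ᶻ r) (U p q r ⁻¹) (Δ ⁻¹) ⟩
        z₂ * ((τ ^ᶻ r − σ ^ᶻ r) * U p q r ⁻¹) * Δ ⁻¹
          ≈⟨ cancel-UΔ z₂ ⟩
        z₂ ∎
        where
        regroup : ∀ κ Q⁻¹ Δ⁻¹ T Z → - (κ * (Q⁻¹ * Δ⁻¹) * T) * Z ≈ - (κ * Q⁻¹ * T * Z * Δ⁻¹)
        regroup = solve 5 (λ κ Q⁻¹ Δ⁻¹ T Z → :- (κ :* (Q⁻¹ :* Δ⁻¹) :* T) :* Z := :- (κ :* Q⁻¹ :* T :* Z :* Δ⁻¹)) refl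
        flip : ∀ z S T U⁻¹ Δ⁻¹ → - (z * ((S − T) * U⁻¹) * Δ⁻¹) ≈ z * ((T − S) * U⁻¹) * Δ⁻¹
        flip = solve 5 (λ z S T U⁻¹ Δ⁻¹ → :- (z :* ((S :- T) :* U⁻¹) :* Δ⁻¹) := z :* ((T :- S) :* U⁻¹) :* Δ⁻¹) refl

      α β : Carrier
      α = A a b * τ ^ᶻ s
      β = B a b * σ ^ᶻ s

      g≈α*z₁^y+β*z₂^y : ∀ y → g y ≈ α * z₁ ^ᶻ y + β * z₂ ^ᶻ y
      g≈α*z₁^y+β*z₂^y y = begin
        ρ ^ᶻ y * W a b p q (r ℤ.* y ℤ.+ s)
          ≈⟨ *-congˡ (W-Binet a b (r ℤ.* y ℤ.+ s)) ⟩
        ρ ^ᶻ y * (A a b * τ ^ᶻ (r ℤ.* y ℤ.+ s) + B a b * σ ^ᶻ (r ℤ.* y ℤ.+ s))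
          ≈⟨ *-congˡ (+-cong (*-congˡ (split τ≉0)) (*-congˡ (split σ≉0))) ⟩
        ρ ^ᶻ y * (A a b * ((τ ^ᶻ r) ^ᶻ y * τ ^ᶻ s) + B a b * ((σ ^ᶻ r) ^ᶻ y * σ ^ᶻ s))
          ≈⟨ regroup (ρ ^ᶻ y) (A a b) (B a b) ((τ ^ᶻ r) ^ᶻ y) ((σ ^ᶻ r) ^ᶻ y) (τ ^ᶻ s) (σ ^ᶻ s) ⟩
        α * (ρ ^ᶻ y * (τ ^ᶻ r) ^ᶻ y) + β * (ρ ^ᶻ y * (σ ^ᶻ r) ^ᶻ y)
          ≈⟨ +-cong (*-congˡ (^ᶻ-distrib-* ρ≉0 (^ᶻ-nonzero τ≉0 r) y)) (*-congˡ (^ᶻ-distrib-* ρ≉0 (^ᶻ-nonzero σ≉0 r) y)) ⟨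
        α * z₁ ^ᶻ y + β * z₂ ^ᶻ y ∎
        where
        split : ∀ {x} → ¬ (x ≈ 0#) → x ^ᶻ (r ℤ.* y ℤ.+ s) ≈ (x ^ᶻ r) ^ᶻ y * x ^ᶻ s
        split x≉0 = trans (^ᶻ-homo-* x≉0 (r ℤ.* y) s) (*-congʳ (sym (^ᶻ-assocʳ x≉0 r y)))
        regroup : ∀ P A B T S Tˢ Sˢ → P * (A * (T * Tˢ) + B * (S * Sˢ)) ≈ A * Tˢ * (P * T) + B * Sˢ * (P * S)
        regroup = solve 7 (λ P A B T S Tˢ Sˢ → P :* (A :* (T :* Tˢ) :+ B :* (S :* Sˢ))
                                               := A :* Tˢ :* (P :* T) :+ B :* Sˢ :* (P :* S)) refl

      geometricTerm : ℤ → ℕ → Carrier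
      geometricTerm y e = ρ ^ᶻ y * θ ^ e * signedBinetForm a b e (idx y e)

      geometricTerm-split : ∀ y e → α * (z₁ ^ᶻ y * u₁ ^ e) + β * (z₂ ^ᶻ y * u₂ ^ e) ≈ geometricTerm y e
      geometricTerm-split y e = begin
        α * (z₁ ^ᶻ y * u₁ ^ e) + β * (z₂ ^ᶻ y * u₂ ^ e)
          ≈⟨ +-cong (*-congˡ (*-cong (^ᶻ-distrib-* ρ≉0 (^ᶻ-nonzero τ≉0 r) y) (^-distrib-* θ _ e)))
                    (*-congˡ (*-cong (^ᶻ-distrib-* ρ≉0 (^ᶻ-nonzero σ≉0 r) y)
                                     (trans ([-x]^n≈[-1]^n*x^n _ e) (*-congˡ (^-distrib-* θ _ e))))) ⟩
        A a b * τ ^ᶻ s * (ρ ^ᶻ y * (τ ^ᶻ r) ^ᶻ y * (θ ^ e * (τ ^ᶻ (r ℤ.+ d)) ^ e))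
          + B a b * σ ^ᶻ s * (ρ ^ᶻ y * (σ ^ᶻ r) ^ᶻ y * ((- 1#) ^ e * (θ ^ e * (σ ^ᶻ (r ℤ.+ d)) ^ e)))
          ≈⟨ regroup (A a b) (τ ^ᶻ s) (B a b) (σ ^ᶻ s) (ρ ^ᶻ y) (θ ^ e) ((τ ^ᶻ r) ^ᶻ y) ((σ ^ᶻ r) ^ᶻ y)
                     ((τ ^ᶻ (r ℤ.+ d)) ^ e) ((σ ^ᶻ (r ℤ.+ d)) ^ e) ((- 1#) ^ e) ⟩
        ρ ^ᶻ y * θ ^ e * (A a b * ((τ ^ᶻ (r ℤ.+ d)) ^ e * ((τ ^ᶻ r) ^ᶻ y * τ ^ᶻ s))
                          + (- 1#) ^ e * (B a b * ((σ ^ᶻ (r ℤ.+ d)) ^ e * ((σ ^ᶻ r) ^ᶻ y * σ ^ᶻ s))))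
          ≈⟨ *-congˡ (+-cong (*-congˡ (split τ≉0)) (*-congˡ (*-congˡ (split σ≉0)))) ⟨
        ρ ^ᶻ y * θ ^ e * signedBinetForm a b e (idx y e) ∎
        where
        split : ∀ {x} → ¬ (x ≈ 0#) → x ^ᶻ idx y e ≈ (x ^ᶻ (r ℤ.+ d)) ^ e * ((x ^ᶻ r) ^ᶻ y * x ^ᶻ s)
        split {x} x≉0 = begin
          x ^ᶻ ((r ℤ.+ d) ℤ.* + e ℤ.+ r ℤ.* y ℤ.+ s)
            ≈⟨ ^ᶻ-homo-* x≉0 ((r ℤ.+ d) ℤ.* + e ℤ.+ r ℤ.* y) s ⟩
          x ^ᶻ ((r ℤ.+ d) ℤ.* + e ℤ.+ r ℤ.* y) * x ^ᶻ s
            ≈⟨ *-congʳ (^ᶻ-homo-* x≉0 ((r ℤ.+ d) ℤ.* + e) (r ℤ.* y)) ⟩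
          (x ^ᶻ ((r ℤ.+ d) ℤ.* + e) * x ^ᶻ (r ℤ.* y)) * x ^ᶻ s
            ≈⟨ *-congʳ (*-cong (sym (^ᶻ-assocʳ x≉0 (r ℤ.+ d) (+ e))) (sym (^ᶻ-assocʳ x≉0 r y))) ⟩
          ((x ^ᶻ (r ℤ.+ d)) ^ e * (x ^ᶻ r) ^ᶻ y) * x ^ᶻ s
            ≈⟨ *-assoc _ _ _ ⟩
          (x ^ᶻ (r ℤ.+ d)) ^ e * ((x ^ᶻ r) ^ᶻ y * x ^ᶻ s) ∎
        regroup : ∀ A Tˢ B Sˢ P Θ Tʸ Sʸ Tᵉ Sᵉ ε →
                  A * Tˢ * (P * Tʸ * (Θ * Tᵉ)) + B * Sˢ * (P * Sʸ * (ε * (Θ * Sᵉ)))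
                  ≈ P * Θ * (A * (Tᵉ * (Tʸ * Tˢ)) + ε * (B * (Sᵉ * (Sʸ * Sˢ))))
        regroup = solve 11 (λ A Tˢ B Sˢ P Θ Tʸ Sʸ Tᵉ Sᵉ ε →
                  A :* Tˢ :* (P :* Tʸ :* (Θ :* Tᵉ)) :+ B :* Sˢ :* (P :* Sʸ :* (ε :* (Θ :* Sᵉ)))
                  := P :* Θ :* (A :* (Tᵉ :* (Tʸ :* Tˢ)) :+ ε :* (B :* (Sᵉ :* (Sʸ :* Sˢ))))) refl

      module G₁ = IteratedGeometric z₁ u₁
      module G₂ = IteratedGeometric z₂ u₂

      iterSum-closedForm : ∀ n x → iterSum n c₀ g x
        ≈ geometricTerm x n − Σ< n (λ k → binom (x ℤ.+ + k ℤ.- c₀) k * geometricTerm c₁ (n ℕ.∸ k))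
      iterSum-closedForm n x = begin
        iterSum n c₀ g x
          ≈⟨ iterSum-cong n c₀ g≈α*z₁^y+β*z₂^y x ⟩
        iterSum n c₀ (λ y → α * z₁ ^ᶻ y + β * z₂ ^ᶻ y) x
          ≈⟨ iterSum-linear n c₀ α β _ _ x ⟩
        α * iterSum n c₀ (z₁ ^ᶻ_) x + β * iterSum n c₀ (z₂ ^ᶻ_) x
          ≈⟨ +-cong (*-congˡ (G₁.iterSum-geometric z₁≉0 u₁[z₁-1]≈z₁ n c₀ x))
                    (*-congˡ (G₂.iterSum-geometric z₂≉0 u₂[z₂-1]≈z₂ n c₀ x)) ⟩
        α * (Z₁ * (u₁ ^ n * z₁ ^ᶻ t − G₁.S n t)) + β * (Z₂ * (u₂ ^ n * z₂ ^ᶻ t − G₂.S n t))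
          ≈⟨ regroup α β Z₁ Z₂ (u₁ ^ n) (u₂ ^ n) (z₁ ^ᶻ t) (z₂ ^ᶻ t) (G₁.S n t) (G₂.S n t) ⟩
        (α * ((Z₁ * z₁ ^ᶻ t) * u₁ ^ n) + β * ((Z₂ * z₂ ^ᶻ t) * u₂ ^ n)) − (α * Z₁ * G₁.S n t + β * Z₂ * G₂.S n t)
          ≈⟨ +-cong (+-cong (*-congˡ (*-congʳ (join z₁≉0))) (*-congˡ (*-congʳ (join z₂≉0))))
                    (-‿cong (+-cong (*-congˡ (G₁.S-closed n t)) (*-congˡ (G₂.S-closed n t)))) ⟩
        (α * (z₁ ^ᶻ x * u₁ ^ n) + β * (z₂ ^ᶻ x * u₂ ^ n)) − (α * Z₁ * Σ< n f₁ + β * Z₂ * Σ< n f₂)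
          ≈⟨ +-cong (geometricTerm-split x n) (-‿cong (sym (Σ<-linear n (α * Z₁) (β * Z₂) f₁ f₂))) ⟩
        geometricTerm x n − Σ< n (λ k → α * Z₁ * f₁ k + β * Z₂ * f₂ k)
          ≈⟨ +-congˡ (-‿cong (Σ<-cong n (λ k _ → term k))) ⟩
        geometricTerm x n − Σ< n (λ k → binom (x ℤ.+ + k ℤ.- c₀) k * geometricTerm c₁ (n ℕ.∸ k)) ∎
        where
        t : ℤ
        t = x ℤ.- c₁
        Z₁ Z₂ : Carrier
        Z₁ = z₁ ^ᶻ c₁
        Z₂ = z₂ ^ᶻ c₁
        f₁ f₂ : ℕ → Carrier
        f₁ k = binom (t ℤ.- ℤ.1ℤ ℤ.+ + k) k * u₁ ^ (n ℕ.∸ k)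
        f₂ k = binom (t ℤ.- ℤ.1ℤ ℤ.+ + k) k * u₂ ^ (n ℕ.∸ k)
        join : ∀ {z} → ¬ (z ≈ 0#) → z ^ᶻ c₁ * z ^ᶻ t ≈ z ^ᶻ x
        join {z} z≉0 = trans (sym (^ᶻ-homo-* z≉0 c₁ t)) (reflexive (≡.cong (z ^ᶻ_) (c+[x-c]≡x c₁ x)))
        term : ∀ k → α * Z₁ * f₁ k + β * Z₂ * f₂ k ≈ binom (x ℤ.+ + k ℤ.- c₀) k * geometricTerm c₁ (n ℕ.∸ k)
        term k = begin
          α * Z₁ * (B′ * u₁ ^ (n ℕ.∸ k)) + β * Z₂ * (B′ * u₂ ^ (n ℕ.∸ k))
            ≈⟨ factor α β Z₁ Z₂ B′ (u₁ ^ (n ℕ.∸ k)) (u₂ ^ (n ℕ.∸ k)) ⟩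
          B′ * (α * (Z₁ * u₁ ^ (n ℕ.∸ k)) + β * (Z₂ * u₂ ^ (n ℕ.∸ k)))
            ≈⟨ *-cong (reflexive (≡.cong (λ i → binom i k) (x-[c-1]-1+k≡x+k-c x c₀ (+ k))))
                      (geometricTerm-split c₁ (n ℕ.∸ k)) ⟩
          binom (x ℤ.+ + k ℤ.- c₀) k * geometricTerm c₁ (n ℕ.∸ k) ∎
          where
          B′ : Carrier
          B′ = binom (t ℤ.- ℤ.1ℤ ℤ.+ + k) k
          factor : ∀ α β Z₁ Z₂ B U₁ U₂ → α * Z₁ * (B * U₁) + β * Z₂ * (B * U₂) ≈ B * (α * (Z₁ * U₁) + β * (Z₂ * U₂))
          factor = solve 7 (λ α β Z₁ Z₂ B U₁ U₂ → α :* Z₁ :* (B :* U₁) :+ β :* Z₂ :* (B :* U₂)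
                                                  := B :* (α :* (Z₁ :* U₁) :+ β :* (Z₂ :* U₂))) refl
        regroup : ∀ α β Z₁ Z₂ U₁ U₂ P₁ P₂ S₁ S₂ →
                  α * (Z₁ * (U₁ * P₁ − S₁)) + β * (Z₂ * (U₂ * P₂ − S₂))
                  ≈ (α * ((Z₁ * P₁) * U₁) + β * ((Z₂ * P₂) * U₂)) − (α * Z₁ * S₁ + β * Z₂ * S₂)
        regroup = solve 10 (λ α β Z₁ Z₂ U₁ U₂ P₁ P₂ S₁ S₂ →
                  α :* (Z₁ :* (U₁ :* P₁ :- S₁)) :+ β :* (Z₂ :* (U₂ :* P₂ :- S₂))
                  := (α :* ((Z₁ :* P₁) :* U₁) :+ β :* ((Z₂ :* P₂) :* U₂)) :- (α :* Z₁ :* S₁ :+ β :* Z₂ :* S₂)) refl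

      θ^e : ∀ e → θ ^ e ≈ κ ^ e * ((q ^ᶻ (d ℤ.* + e)) ⁻¹ * (Δ ^ e) ⁻¹)
      θ^e e = begin
        (κ * ((q ^ᶻ d) ⁻¹ * Δ ⁻¹)) ^ e               ≈⟨ ^-distrib-* κ _ e ⟩
        κ ^ e * ((q ^ᶻ d) ⁻¹ * Δ ⁻¹) ^ e             ≈⟨ *-congˡ (^-distrib-* ((q ^ᶻ d) ⁻¹) (Δ ⁻¹) e) ⟩
        κ ^ e * (((q ^ᶻ d) ⁻¹) ^ e * (Δ ⁻¹) ^ e)     ≈⟨ *-congˡ (*-cong Q-part (⁻¹-^ e Δ≉0)) ⟩
        κ ^ e * ((q ^ᶻ (d ℤ.* + e)) ⁻¹ * (Δ ^ e) ⁻¹) ∎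
        where
        Q-part : ((q ^ᶻ d) ⁻¹) ^ e ≈ (q ^ᶻ (d ℤ.* + e)) ⁻¹
        Q-part = trans (⁻¹-^ e (^ᶻ-nonzero q≉0 d))
                       (⁻¹-cong (^ᶻ-assocʳ q≉0 d (+ e)) (^ᶻ-nonzero q≉0 (d ℤ.* + e)))

      Δ⁻ᵃ*Δ⁻ᵇ≈Δ⁻⁽ᵃ⁺ᵇ⁾ : ∀ a b → (Δ ^ a) ⁻¹ * (Δ ^ b) ⁻¹ ≈ (Δ ^ (a ℕ.+ b)) ⁻¹
      Δ⁻ᵃ*Δ⁻ᵇ≈Δ⁻⁽ᵃ⁺ᵇ⁾ a b = trans (sym (⁻¹-distrib-* (^-nonzero a Δ≉0) (^-nonzero b Δ≉0)))
                                  (⁻¹-cong (sym (^-homo-* Δ a b)) (^-nonzero (a ℕ.+ b) Δ≉0))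

      Δʲ*Δ⁻⁽ʲ⁺ᵃ⁾≈Δ⁻ᵃ : ∀ j a → Δ ^ j * (Δ ^ (j ℕ.+ a)) ⁻¹ ≈ (Δ ^ a) ⁻¹
      Δʲ*Δ⁻⁽ʲ⁺ᵃ⁾≈Δ⁻ᵃ j a = begin
        Δ ^ j * (Δ ^ (j ℕ.+ a)) ⁻¹           ≈⟨ *-congˡ (Δ⁻ᵃ*Δ⁻ᵇ≈Δ⁻⁽ᵃ⁺ᵇ⁾ j a) ⟨
        Δ ^ j * ((Δ ^ j) ⁻¹ * (Δ ^ a) ⁻¹)    ≈⟨ *-assoc _ _ _ ⟨
        (Δ ^ j * (Δ ^ j) ⁻¹) * (Δ ^ a) ⁻¹    ≈⟨ *-congʳ (⁻¹-inverseʳ (^-nonzero j Δ≉0)) ⟩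
        1# * (Δ ^ a) ⁻¹                      ≈⟨ *-identityˡ _ ⟩
        (Δ ^ a) ⁻¹                           ∎

      signedBinetForm≈W : ∀ {e} i → e ≡ 2 ℕ.* i → ∀ k → signedBinetForm a b e k ≈ W a b p q k * (Δ ^ 0) ⁻¹
      signedBinetForm≈W i ≡.refl k =
        trans (signedBinetForm-even a b i k) (sym (trans (*-congˡ 1⁻¹≈1) (*-identityʳ _)))

      signedBinetForm≈X : ∀ {e} i → e ≡ 2 ℕ.* i ℕ.+ 1 → ∀ k → signedBinetForm a b e k ≈ X k * (Δ ^ 1) ⁻¹
      signedBinetForm≈X i ≡.refl k =
        trans (signedBinetForm-odd a b i k) (*-congˡ (⁻¹-cong (sym (*-identityʳ Δ)) (^-nonzero 1 Δ≉0)))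

      geometricTerm-leading : ∀ x n ε N (G : ℤ → Carrier) →
        signedBinetForm a b n (idx x n) ≈ G (idx x n) * (Δ ^ ε) ⁻¹ → n ℕ.+ ε ≡ N →
        geometricTerm x n ≈ (1# / ((q ^ᶻ (d ℤ.* + n)) * Δ ^ N)) * κ ^ n * ρ ^ᶻ x
                            * G (r ℤ.* (+ n ℤ.+ x) ℤ.+ d ℤ.* + n ℤ.+ s)
      geometricTerm-leading x n ε N G Y≈ ≡.refl = begin
        ρ ^ᶻ x * θ ^ n * signedBinetForm a b n (idx x n)
          ≈⟨ *-cong (*-congˡ (θ^e n)) Y≈ ⟩
        ρ ^ᶻ x * (κ ^ n * (Q⁻¹ * (Δ ^ n) ⁻¹)) * (G (idx x n) * (Δ ^ ε) ⁻¹)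
          ≈⟨ regroup (ρ ^ᶻ x) (κ ^ n) Q⁻¹ ((Δ ^ n) ⁻¹) ((Δ ^ ε) ⁻¹) (G (idx x n)) ⟩
        (1# * (Q⁻¹ * ((Δ ^ n) ⁻¹ * (Δ ^ ε) ⁻¹))) * κ ^ n * ρ ^ᶻ x * G (idx x n)
          ≈⟨ *-congʳ (*-congʳ (*-congʳ (*-congˡ (trans (*-congˡ (Δ⁻ᵃ*Δ⁻ᵇ≈Δ⁻⁽ᵃ⁺ᵇ⁾ n ε))
                (sym (⁻¹-distrib-* (^ᶻ-nonzero q≉0 (d ℤ.* + n)) (^-nonzero (n ℕ.+ ε) Δ≉0))))))) ⟩
        (1# / ((q ^ᶻ (d ℤ.* + n)) * Δ ^ (n ℕ.+ ε))) * κ ^ n * ρ ^ᶻ x * G (idx x n)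
          ≡⟨ ≡.cong (λ i → (1# / ((q ^ᶻ (d ℤ.* + n)) * Δ ^ (n ℕ.+ ε))) * κ ^ n * ρ ^ᶻ x * G i)
                    ([r+d]*n+r*x+s≡r*[n+x]+d*n+s r d (+ n) x s) ⟩
        (1# / ((q ^ᶻ (d ℤ.* + n)) * Δ ^ (n ℕ.+ ε))) * κ ^ n * ρ ^ᶻ x * G (r ℤ.* (+ n ℤ.+ x) ℤ.+ d ℤ.* + n ℤ.+ s) ∎
        where
        Q⁻¹ : Carrier
        Q⁻¹ = (q ^ᶻ (d ℤ.* + n)) ⁻¹
        regroup : ∀ P K Q D E F → P * (K * (Q * D)) * (F * E) ≈ (1# * (Q * (D * E))) * K * P * F
        regroup = solve 6 (λ P K Q D E F → P :* (K :* (Q :* D)) :* (F :* E)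
                                           := (con ℤ.1ℤ :* (Q :* (D :* E))) :* K :* P :* F) refl

      geometricTerm-summand : ∀ j e ε N B (F : ℤ → Carrier) →
        signedBinetForm a b e (idx c₁ e) ≈ F (idx c₁ e) * (Δ ^ ε) ⁻¹ → j ℕ.+ (e ℕ.+ ε) ≡ N →
        B * geometricTerm c₁ e ≈ ρ ^ᶻ c₁ * (1# / Δ ^ N) * ((Δ ^ j / q ^ᶻ (d ℤ.* + e)) * κ ^ e * F (idx c₁ e) * B)
      geometricTerm-summand j e ε N B F Y≈ ≡.refl = begin
        B * (P * θ ^ e * signedBinetForm a b e (idx c₁ e))
          ≈⟨ *-congˡ (*-cong (*-congˡ (θ^e e)) Y≈) ⟩
        B * (P * (κ ^ e * (Q⁻¹ * (Δ ^ e) ⁻¹)) * (Fe * (Δ ^ ε) ⁻¹))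
          ≈⟨ collect B P (κ ^ e) Q⁻¹ ((Δ ^ e) ⁻¹) ((Δ ^ ε) ⁻¹) Fe ⟩
        B * P * κ ^ e * Q⁻¹ * Fe * ((Δ ^ e) ⁻¹ * (Δ ^ ε) ⁻¹)
          ≈⟨ *-congˡ (trans (Δ⁻ᵃ*Δ⁻ᵇ≈Δ⁻⁽ᵃ⁺ᵇ⁾ e ε) (sym (Δʲ*Δ⁻⁽ʲ⁺ᵃ⁾≈Δ⁻ᵃ j (e ℕ.+ ε)))) ⟩
        B * P * κ ^ e * Q⁻¹ * Fe * (Δ ^ j * (Δ ^ (j ℕ.+ (e ℕ.+ ε))) ⁻¹)
          ≈⟨ distribute B P (κ ^ e) Q⁻¹ Fe (Δ ^ j) ((Δ ^ (j ℕ.+ (e ℕ.+ ε))) ⁻¹) ⟩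
        P * (1# / Δ ^ (j ℕ.+ (e ℕ.+ ε))) * ((Δ ^ j / q ^ᶻ (d ℤ.* + e)) * κ ^ e * Fe * B) ∎
        where
        P Q⁻¹ Fe : Carrier
        P   = ρ ^ᶻ c₁
        Q⁻¹ = (q ^ᶻ (d ℤ.* + e)) ⁻¹
        Fe  = F (idx c₁ e)
        collect : ∀ B P K Q D E F → B * (P * (K * (Q * D)) * (F * E)) ≈ B * P * K * Q * F * (D * E)
        collect = solve 7 (λ B P K Q D E F → B :* (P :* (K :* (Q :* D)) :* (F :* E))
                                             := B :* P :* K :* Q :* F :* (D :* E)) refl
        distribute : ∀ B P K Q F Dʲ Dᴺ → B * P * K * Q * F * (Dʲ * Dᴺ) ≈ P * (1# * Dᴺ) * ((Dʲ * Q) * K * F * B)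
        distribute = solve 7 (λ B P K Q F Dʲ Dᴺ → B :* P :* K :* Q :* F :* (Dʲ :* Dᴺ)
                                                  := P :* (con ℤ.1ℤ :* Dᴺ) :* ((Dʲ :* Q) :* K :* F :* B)) refl

      summand₂ⱼ summand₂ⱼ₋₁ : (ℤ → Carrier) → ℕ → ℤ → ℕ → Carrier
      summand₂ⱼ F n x j = (Δ ^ (2 ℕ.* j) / q ^ᶻ (d ℤ.* + (n ℕ.∸ 2 ℕ.* j))) * κ ^ (n ℕ.∸ 2 ℕ.* j)
                          * F (idx c₁ (n ℕ.∸ 2 ℕ.* j)) * binom (x ℤ.+ + (2 ℕ.* j) ℤ.- c₀) (2 ℕ.* j)
      summand₂ⱼ₋₁ F n x j = (Δ ^ (2 ℕ.* j) / q ^ᶻ (d ℤ.* + ((n ℕ.∸ 2 ℕ.* j) ℕ.+ 1))) * κ ^ ((n ℕ.∸ 2 ℕ.* j) ℕ.+ 1)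
                            * F (idx c₁ ((n ℕ.∸ 2 ℕ.* j) ℕ.+ 1)) * binom (x ℤ.+ + (2 ℕ.* j) ℤ.- ℤ.1ℤ ℤ.- c₀) (2 ℕ.* j ℕ.∸ 1)

      oddIndexTerm-reindex : ∀ n x j → 2 ℕ.* suc j ℕ.≤ n →
        binom (x ℤ.+ + suc (2 ℕ.* j) ℤ.- c₀) (suc (2 ℕ.* j)) * geometricTerm c₁ (n ℕ.∸ suc (2 ℕ.* j))
        ≡ binom (x ℤ.+ + (2 ℕ.* suc j) ℤ.- ℤ.1ℤ ℤ.- c₀) (2 ℕ.* suc j ℕ.∸ 1) * geometricTerm c₁ ((n ℕ.∸ 2 ℕ.* suc j) ℕ.+ 1)
      oddIndexTerm-reindex n x j 2[1+j]≤n = ≡.cong₂ _*_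
        (≡.cong₂ binom (≡.trans (x+[1+k]-c≡x+[2+k]-1-c x (+ (2 ℕ.* j)) c₀)
                                (≡.cong (λ t → x ℤ.+ + t ℤ.- ℤ.1ℤ ℤ.- c₀) (≡.sym (ℕP.*-suc 2 j))))
                       (≡.cong (ℕ._∸ 1) (≡.sym (ℕP.*-suc 2 j))))
        (≡.cong (geometricTerm c₁) (n∸[1+2j]≡[n∸2[1+j]]+1 j 2[1+j]≤n))

      iterSum-even : ∀ m x → let n = 2 ℕ.* suc m in
        iterSum n c₀ g x ≈
          (1# / ((q ^ᶻ (d ℤ.* + n)) * Δ ^ n)) * κ ^ n * (ρ ^ᶻ x) * W a b p q (r ℤ.* (+ n ℤ.+ x) ℤ.+ d ℤ.* + n ℤ.+ s)
          − (ρ ^ᶻ c₁) * (1# / Δ ^ n) * Σℕ[ 0 to m ] (summand₂ⱼ (W a b p q) n x)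
          − (ρ ^ᶻ c₁) * (1# / Δ ^ (n ℕ.+ 2)) * Σℕ[ 1 to suc m ] (summand₂ⱼ₋₁ X n x)
      iterSum-even m x = begin
        iterSum n c₀ g x
          ≈⟨ iterSum-closedForm n x ⟩
        geometricTerm x n − Σ< n term
          ≈⟨ +-congˡ (-‿cong (Σ<-even+odd (suc m) term)) ⟩
        geometricTerm x n − (Σ< (suc m) (λ j → term (2 ℕ.* j)) + Σ< (suc m) (λ j → term (suc (2 ℕ.* j))))
          ≈⟨ +-cong (geometricTerm-leading x n 0 n (W a b p q) (signedBinetForm≈W (suc m) ≡.refl (idx x n)) (ℕP.+-identityʳ n))
                    (-‿cong (+-cong (trans (Σ<-cong (suc m) even) (sym (*-distribˡ-Σ< (suc m) _ _)))
                                    (trans (Σ<-cong (suc m) odd) (sym (*-distribˡ-Σ< (suc m) _ _))))) ⟩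
        _ ≈⟨ x-[y+z]≈x-y-z _ _ _ ⟩
        _ ∎
        where
        n : ℕ
        n = 2 ℕ.* suc m
        term : ℕ → Carrier
        term k = binom (x ℤ.+ + k ℤ.- c₀) k * geometricTerm c₁ (n ℕ.∸ k)
        even : ∀ j → j ℕ.< suc m → term (2 ℕ.* j) ≈ ρ ^ᶻ c₁ * (1# / Δ ^ n) * summand₂ⱼ (W a b p q) n x j
        even j j<1+m = geometricTerm-summand (2 ℕ.* j) (n ℕ.∸ 2 ℕ.* j) 0 n _ (W a b p q)
          (signedBinetForm≈W (suc m ℕ.∸ j) (≡.sym (ℕP.*-distribˡ-∸ 2 (suc m) j)) (idx c₁ (n ℕ.∸ 2 ℕ.* j)))
          (≡.trans (j+[[n∸j]+a]≡n+a (ℕP.*-monoʳ-≤ 2 (ℕP.<⇒≤ j<1+m)) 0) (ℕP.+-identityʳ n))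
        odd : ∀ j → j ℕ.< suc m → term (suc (2 ℕ.* j)) ≈ ρ ^ᶻ c₁ * (1# / Δ ^ (n ℕ.+ 2)) * summand₂ⱼ₋₁ X n x (suc j)
        odd j j<1+m = trans (reflexive (oddIndexTerm-reindex n x j 2[1+j]≤n))
          (geometricTerm-summand (2 ℕ.* suc j) ((n ℕ.∸ 2 ℕ.* suc j) ℕ.+ 1) 1 (n ℕ.+ 2) _ X
            (signedBinetForm≈X (suc m ℕ.∸ suc j) (≡.cong (ℕ._+ 1) (≡.sym (ℕP.*-distribˡ-∸ 2 (suc m) (suc j))))
              (idx c₁ ((n ℕ.∸ 2 ℕ.* suc j) ℕ.+ 1)))
            (j+[[[n∸j]+1]+a]≡n+[1+a] 2[1+j]≤n 1))
          where
          2[1+j]≤n : 2 ℕ.* suc j ℕ.≤ n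
          2[1+j]≤n = ℕP.*-monoʳ-≤ 2 j<1+m

      iterSum-odd : ∀ m x → let n = 2 ℕ.* m ℕ.+ 1 in
        iterSum n c₀ g x ≈
          (1# / ((q ^ᶻ (d ℤ.* + n)) * Δ ^ (n ℕ.+ 1))) * κ ^ n * (ρ ^ᶻ x) * X (r ℤ.* (+ n ℤ.+ x) ℤ.+ d ℤ.* + n ℤ.+ s)
          − (ρ ^ᶻ c₁) * (1# / Δ ^ (n ℕ.+ 1)) * Σℕ[ 0 to m ] (summand₂ⱼ X n x)
          − (ρ ^ᶻ c₁) * (1# / Δ ^ (n ℕ.+ 1)) * Σℕ[ 1 to m ] (summand₂ⱼ₋₁ (W a b p q) n x)
      iterSum-odd m x = begin
        iterSum n c₀ g x
          ≈⟨ iterSum-closedForm n x ⟩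
        geometricTerm x n − Σ< n term
          ≈⟨ +-congˡ (-‿cong (trans (reflexive (≡.cong (λ k → Σ< k term) (ℕP.+-comm (2 ℕ.* m) 1))) (Σ<-odd-length m term))) ⟩
        geometricTerm x n − (Σ< (suc m) (λ j → term (2 ℕ.* j)) + Σ< m (λ j → term (suc (2 ℕ.* j))))
          ≈⟨ +-cong (geometricTerm-leading x n 1 (n ℕ.+ 1) X (signedBinetForm≈X m ≡.refl (idx x n)) ≡.refl)
                    (-‿cong (+-cong (trans (Σ<-cong (suc m) even) (sym (*-distribˡ-Σ< (suc m) _ _)))
                                    (trans (Σ<-cong m odd) (sym (*-distribˡ-Σ< m _ _))))) ⟩
        _ ≈⟨ x-[y+z]≈x-y-z _ _ _ ⟩
        _ ∎
        where
        n : ℕ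
        n = 2 ℕ.* m ℕ.+ 1
        term : ℕ → Carrier
        term k = binom (x ℤ.+ + k ℤ.- c₀) k * geometricTerm c₁ (n ℕ.∸ k)
        2m≤n : 2 ℕ.* m ℕ.≤ n
        2m≤n = ℕP.m≤m+n (2 ℕ.* m) 1
        even : ∀ j → j ℕ.< suc m → term (2 ℕ.* j) ≈ ρ ^ᶻ c₁ * (1# / Δ ^ (n ℕ.+ 1)) * summand₂ⱼ X n x j
        even j j<1+m = geometricTerm-summand (2 ℕ.* j) (n ℕ.∸ 2 ℕ.* j) 1 (n ℕ.+ 1) _ X
          (signedBinetForm≈X (m ℕ.∸ j) ([2m+1]∸2j≡2[m∸j]+1 m j j≤m) (idx c₁ (n ℕ.∸ 2 ℕ.* j)))
          (j+[[n∸j]+a]≡n+a (ℕP.≤-trans (ℕP.*-monoʳ-≤ 2 j≤m) 2m≤n) 1)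
          where
          j≤m : j ℕ.≤ m
          j≤m = ℕP.≤-pred j<1+m
        odd : ∀ j → j ℕ.< m → term (suc (2 ℕ.* j)) ≈ ρ ^ᶻ c₁ * (1# / Δ ^ (n ℕ.+ 1)) * summand₂ⱼ₋₁ (W a b p q) n x (suc j)
        odd j j<m = trans (reflexive (oddIndexTerm-reindex n x j (ℕP.≤-trans (ℕP.*-monoʳ-≤ 2 j<m) 2m≤n)))
          (geometricTerm-summand (2 ℕ.* suc j) ((n ℕ.∸ 2 ℕ.* suc j) ℕ.+ 1) 0 (n ℕ.+ 1) _ (W a b p q)
            (signedBinetForm≈W (suc (m ℕ.∸ suc j))
              (≡.trans (≡.cong (ℕ._+ 1) ([2m+1]∸2j≡2[m∸j]+1 m (suc j) j<m)) (2i+1+1≡2[1+i] (m ℕ.∸ suc j)))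
              (idx c₁ ((n ℕ.∸ 2 ℕ.* suc j) ℕ.+ 1)))
            (j+[[[n∸j]+1]+a]≡n+[1+a] (ℕP.≤-trans (ℕP.*-monoʳ-≤ 2 j<m) 2m≤n) 0))

theorem6 :
  ∀ {c ℓ : Level} (R : CommutativeRing c ℓ) (F : IsCharZeroField R) →
  let open CommutativeRing R
      open IsCharZeroField F
      open Horadam R F
  in
  ∀ (a b p q Δ : Carrier) →
  ¬ (p ≈ 0#) → ¬ (q ≈ 0#) →
  ¬ (p * p − ℕ→R R 4 * q ≈ 0#) →
  Δ * Δ ≈ p * p − ℕ→R R 4 * q →
  ∀ (r s c₀ d aₙ : ℤ) →
  r ≢ ℤ.0ℤ →
  ¬ (U p q r ≈ 0#) → ¬ (V p q d ≈ 0#) → ¬ (V p q (r ℤ.+ d) ≈ 0#) →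
  let W' = W a b p q
      ρ = V p q d / V p q (r ℤ.+ d)
      κ = V p q d / U p q r
      g = λ (a₀ : ℤ) → (ρ ^ᶻ a₀) * W' (r ℤ.* a₀ ℤ.+ s)
      LHS = λ (n : ℕ) → iterSum n c₀ g aₙ
      X = λ (k : ℤ) → W' (k ℤ.+ ℤ.1ℤ) − q * W' (k ℤ.- ℤ.1ℤ)
      c₁ = c₀ ℤ.- ℤ.1ℤ
      idx = λ (e : ℕ) → (r ℤ.+ d) ℤ.* + e ℤ.+ r ℤ.* c₁ ℤ.+ s
  in
  -- n positive even:  n = 2(m+1),  (n-2)/2 = m,  n/2 = m+1
  (∀ (m : ℕ) →
    let n = 2 ℕ.* suc m in
    LHS n ≈
      (1# / ((q ^ᶻ (d ℤ.* + n)) * Δ ^ n)) * κ ^ n * (ρ ^ᶻ aₙ)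
        * W' (r ℤ.* (+ n ℤ.+ aₙ) ℤ.+ d ℤ.* + n ℤ.+ s)
      − (ρ ^ᶻ c₁) * (1# / Δ ^ n) *
          Σℕ[ 0 to m ] (λ j →
            (Δ ^ (2 ℕ.* j) / q ^ᶻ (d ℤ.* + (n ℕ.∸ 2 ℕ.* j)))
              * κ ^ (n ℕ.∸ 2 ℕ.* j)
              * W' (idx (n ℕ.∸ 2 ℕ.* j))
              * binom (aₙ ℤ.+ + (2 ℕ.* j) ℤ.- c₀) (2 ℕ.* j))
      − (ρ ^ᶻ c₁) * (1# / Δ ^ (n ℕ.+ 2)) *
          Σℕ[ 1 to suc m ] (λ j →
            (Δ ^ (2 ℕ.* j) / q ^ᶻ (d ℤ.* + ((n ℕ.∸ 2 ℕ.* j) ℕ.+ 1)))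
              * κ ^ ((n ℕ.∸ 2 ℕ.* j) ℕ.+ 1)
              * X (idx ((n ℕ.∸ 2 ℕ.* j) ℕ.+ 1))
              * binom (aₙ ℤ.+ + (2 ℕ.* j) ℤ.- ℤ.1ℤ ℤ.- c₀) (2 ℕ.* j ℕ.∸ 1)))
  ×
  -- n positive odd:  n = 2m+1,  (n-1)/2 = m
  (∀ (m : ℕ) →
    let n = 2 ℕ.* m ℕ.+ 1 in
    LHS n ≈
      (1# / ((q ^ᶻ (d ℤ.* + n)) * Δ ^ (n ℕ.+ 1))) * κ ^ n * (ρ ^ᶻ aₙ)
        * X (r ℤ.* (+ n ℤ.+ aₙ) ℤ.+ d ℤ.* + n ℤ.+ s)
      − (ρ ^ᶻ c₁) * (1# / Δ ^ (n ℕ.+ 1)) *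
          Σℕ[ 0 to m ] (λ j →
            (Δ ^ (2 ℕ.* j) / q ^ᶻ (d ℤ.* + (n ℕ.∸ 2 ℕ.* j)))
              * κ ^ (n ℕ.∸ 2 ℕ.* j)
              * X (idx (n ℕ.∸ 2 ℕ.* j))
              * binom (aₙ ℤ.+ + (2 ℕ.* j) ℤ.- c₀) (2 ℕ.* j))
      − (ρ ^ᶻ c₁) * (1# / Δ ^ (n ℕ.+ 1)) *
          Σℕ[ 1 to m ] (λ j →
            (Δ ^ (2 ℕ.* j) / q ^ᶻ (d ℤ.* + ((n ℕ.∸ 2 ℕ.* j) ℕ.+ 1)))
              * κ ^ ((n ℕ.∸ 2 ℕ.* j) ℕ.+ 1)
              * W' (idx ((n ℕ.∸ 2 ℕ.* j) ℕ.+ 1))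
              * binom (aₙ ℤ.+ + (2 ℕ.* j) ℤ.- ℤ.1ℤ ℤ.- c₀) (2 ℕ.* j ℕ.∸ 1)))
theorem6 R F a b p q Δ _ q≉0 p²-4q≉0 Δ²≈p²-4q r s c₀ d aₙ _ Uᵣ≉0 Vd≉0 Vr+d≉0 =
  (λ m → iterSum-even m aₙ) , (λ m → iterSum-odd m aₙ)
  where open Binet.IteratedSum R F p q Δ q≉0 Δ²≈p²-4q p²-4q≉0 a b r s c₀ d Uᵣ≉0 Vd≉0 Vr+d≉0
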